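{- Let $a,s,d$ be non-negative integers with $s\le a$, $s\le d$, and $a+s+d+1$ not divisible by $3$. Then there is a unique $(3,a+s+d+1)$-Dyck path $\Pi$ with $\operatorname{area}(\Pi)=a$, $\operatorname{skip}(\Pi)=s$ and $\operatorname{dinv}(\Pi)=d$.
   Context: For $n$ not divisible by 3, a $(3,n)$-Dyck path is a lattice path from $(0,0)$ to $(3,n)$ using unit north and east steps that stays weakly above the line $y=\frac{n}{3}x$. The cell $(a,b)$ ($a\in\{1,2,3\}$ column from left, $b\in\{1,\dots,n\}$ row from bottom) is $[a-1,a]\times[b-1,b]$. $\lambda(\Pi)$ is the set of cells lying above (north-west of) $\Pi$. $\operatorname{area}(\Pi)$ is the number of cells lying entirely below $\Pi$ and above the line $y=\frac n3x$. For $x\in\lambda(\Pi)$, $\operatorname{arm}(x)$ (resp. $\operatorname{leg}(x)$) is the number of cells of $\lambda(\Pi)$ strictly east (resp. strictly south) of $x$ in its row (resp. column). $\operatorname{dinv}(\Pi)$ is the number of $x\in\lambda(\Pi)$ with $\frac{\operatorname{arm}(x)}{\operatorname{leg}(x)+1}<\frac{3}{n}<\frac{\operatorname{arm}(x)+1}{\operatorname{leg}(x)}$ (right side $+\infty$ if $\operatorname{leg}(x)=0$). The rank of cell $(a,b)$ is $-an+3(b-1)$. The rank word of $\Pi$ is the list of all positive ranks of cells in increasing order (they lie in columns 1 and 2 and are distinct), with each entry whose cell lies in $\lambda(\Pi)$ marked ("boxed"). A skip of $\Pi$ is a maximal block of consecutive unboxed entries of the rank word having at least one boxed entry somewhere to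 its left and at least one somewhere to its right; $\operatorname{skip}(\Pi)$ is the number of skips. -}

module Defs where

open import Data.Nat using (ℕ; zero; suc; _+_; _*_; _∸_; _≤_; _<ᵇ_; _≡ᵇ_)
open import Data.Bool using (Bool; true; false; if_then_else_; _∧_; _∨_; not)
open import Data.List using (List; []; _∷_; map; concatMap; filterᵇ; length; upTo; take; sum)
open import Data.Bool.ListAction using (any)
open import Data.Product using (_×_; _,_; proj₁; proj₂)
open import Relation.Binary.PropositionalEquality using (_≡_)

data Step : Set where
  N E : Step

isN isE : Step → Bool
isN N = true
isN E = false
isE N = false
isE E = true

#N #E : List Step → ℕ
#N p = length (filterᵇ isN p)
#E p = length (filterᵇ isE p)

-- A (3,n)-Dyck path: lattice path from (0,0) to (3,n) with unit N/E steps
-- staying weakly above y = (n/3) x.  Since the line is increasing, it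
-- suffices (and is necessary) that every lattice point (x,y) visited,
-- i.e. every prefix endpoint, satisfies 3y ≥ n x.
record IsDyck (n : ℕ) (p : List Step) : Set where
  field
    northCount : #N p ≡ n
    eastCount  : #E p ≡ 3
    weaklyAbove : ∀ k → n * #E (take k p) ≤ 3 * #N (take k p)

nBefore : List Step → ℕ → ℕ
nBefore []      k       = 0
nBefore (N ∷ s) k       = suc (nBefore s k)
nBefore (E ∷ s) zero    = 0
nBefore (E ∷ s) (suc k) = nBefore s k

-- height h_a of the a-th east step (a ∈ {1,2,3}); it runs from (a-1,h_a) to (a,h_a)
height : List Step → ℕ → ℕ
height p a = nBefore p (a ∸ 1)

-- Cells (a,b) = [a-1,a] × [b-1,b], a ∈ {1,2,3}, b ∈ {1..n}

Cell : Set
Cell = ℕ × ℕ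

range1 : ℕ → List ℕ
range1 m = map suc (upTo m)

cells : ℕ → List Cell
cells n = concatMap (λ a → map (λ b → (a , b)) (range1 n)) (range1 3)

countᵇ : {A : Set} → (A → Bool) → List A → ℕ
countᵇ P xs = length (filterᵇ P xs)

-- the cell (a,b) lies above (north-west of) Π, i.e. belongs to λ(Π):  b-1 ≥ h_a
inLambda : List Step → Cell → Bool
inLambda p (a , b) = height p a <ᵇ b

-- the cell lies entirely below Π:  b ≤ h_a
belowPath : List Step → Cell → Bool
belowPath p (a , b) = b <ᵇ suc (height p a)

-- the cell lies entirely above the line y = n x / 3: its lowest-right
-- corner (a, b-1) satisfies 3(b-1) ≥ n a
aboveLine : ℕ → Cell → Bool
aboveLine n (a , b) = (n * a) <ᵇ suc (3 * (b ∸ 1))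

area : ℕ → List Step → ℕ
area n p = countᵇ (λ c → belowPath p c ∧ aboveLine n c) (cells n)

arm : ℕ → List Step → Cell → ℕ
arm n p (a , b) = countᵇ (λ c → (a <ᵇ proj₁ c) ∧ ((proj₂ c ≡ᵇ b) ∧ inLambda p c)) (cells n)

leg : ℕ → List Step → Cell → ℕ
leg n p (a , b) = countᵇ (λ c → (proj₁ c ≡ᵇ a) ∧ ((proj₂ c <ᵇ b) ∧ inLambda p c)) (cells n)

-- arm/(leg+1) < 3/n < (arm+1)/leg  (right side +∞ when leg = 0),
-- written with cleared (positive) denominators
dinvCondition : ℕ → ℕ → ℕ → Bool
dinvCondition n ar lg = ((ar * n) <ᵇ (3 * suc lg)) ∧ ((lg ≡ᵇ 0) ∨ ((3 * lg) <ᵇ (n * suc ar)))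

dinv : ℕ → List Step → ℕ
dinv n p = countᵇ (λ c → inLambda p c ∧ dinvCondition n (arm n p c) (leg n p c)) (cells n)

-- rank of (a,b) is -a n + 3(b-1); it is positive iff a n < 3(b-1)
positiveRank : ℕ → Cell → Bool
positiveRank n (a , b) = (n * a) <ᵇ (3 * (b ∸ 1))

-- its value when positive
rankValue : ℕ → Cell → ℕ
rankValue n (a , b) = 3 * (b ∸ 1) ∸ n * a

-- rank word: positive ranks in increasing order (every positive rank of a
-- cell with b ≤ n is < 3n), each paired with its "boxed" mark
rankWord : ℕ → List Step → List (ℕ × Bool)
rankWord n p =
  concatMap (λ r → map (λ c → (r , inLambda p c))
                       (filterᵇ (λ c → positiveRank n c ∧ (rankValue n c ≡ᵇ r)) (cells n)))
            (range1 (3 * n))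

collapse : List Bool → List Bool
collapse []           = []
collapse (x ∷ [])     = x ∷ []
collapse (x ∷ y ∷ xs) with collapse (y ∷ xs)
... | ys = if (x ∧ y) ∨ (not x ∧ not y) then ys else x ∷ ys

-- number of (collapsed) unboxed blocks with a boxed entry to the left and to the right
countSkips : Bool → List Bool → ℕ
countSkips seen []          = 0
countSkips seen (true ∷ xs)  = countSkips true xs
countSkips seen (false ∷ xs) =
  (if seen ∧ any (λ z → z) xs then 1 else 0) + countSkips seen xs

skip : ℕ → List Step → ℕ
skip n p = countSkips false (collapse (map proj₂ (rankWord n p)))

-- A (3, n)-Dyck path is N^i E N^j E N^k E.  Writing n = 3m + 1 + r with r ≤ 1, it is
-- determined by the excesses p₁, p₂ of its first two east steps over the lowest heights
-- m + 1 and 2m + 1 + r that the line allows, subject to p₂ ≤ m and p₁ ≤ m + r + p₂.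
-- All three statistics are then explicit.  The area is p₁ + p₂.  In dinv every cell of
-- λ(Π) in column 2 counts, and a cell of column 1 counts according to how its leg
-- compares with m.  The positive ranks of column 1 and column 2 interleave, and the
-- boxed ones are exactly those from rank index p₁, resp. p₂, on; the skips are read off
-- from the resulting runs.  The outcome is piecewise linear on three regions of the
-- (p₁, p₂)-triangle (see Region), and each piece is inverted explicitly: dinv ≤ m
-- singles out region III, and the parity of dinv separates regions I and II.

module Submission where

open import Defs
open import Data.Nat
open import Data.Nat.Properties
open import Data.Bool using (Bool; true; false; _∧_; T; _∨_; if_then_else_)
open import Data.List using (List; []; _∷_; _++_; map; concatMap; filterᵇ; length; applyUpTo; replicate; take)
open import Data.List.Properties using (length-++; filter-++; ++-identityʳ; ++-assoc; filter-accept; filter-reject; map-concatMap; concatMap-cong; map-∘)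
open import Data.Product using (_,_; Σ; _×_; proj₁; proj₂; ∃!)
open import Relation.Binary.PropositionalEquality
open import Data.Empty using (⊥-elim; ⊥)
open import Data.Unit using (tt)
open import Relation.Nullary.Decidable using (T?)
open import Function using (_∘_)
open import Data.Nat.Tactic.RingSolver
open import Data.Bool.Properties using (∨-zeroʳ; ∧-identityʳ)
open import Relation.Nullary using (yes; no; ¬_)
open import Data.Bool.ListAction using (any)
open import Data.Sum using (_⊎_; inj₁; inj₂)
open import Data.Nat.DivMod using (_%_; _/_; m≡m%n+[m/n]*n; m%n<n)
open import Data.Nat.Divisibility using (_∣_; m%n≡0⇒n∣m)

-- Counting along intervals of ℕ

≤-witness : ∀ {m n} k → n ≡ m + k → m ≤ n
≤-witness {m} k refl = m≤m+n m k

<ᵇ-true : ∀ {m n} → m < n → (m <ᵇ n) ≡ true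
<ᵇ-true {m} {n} m<n with m <ᵇ n | <⇒<ᵇ m<n
... | true | _ = refl

<ᵇ-false : ∀ {m n} → n ≤ m → (m <ᵇ n) ≡ false
<ᵇ-false {m} {n} n≤m with m <ᵇ n in eq
... | false = refl
... | true  = ⊥-elim (<⇒≱ (<ᵇ⇒< m n (subst T (sym eq) tt)) n≤m)

<ᵇ-≡ : ∀ {m n u v} → (m < n → u < v) → (u < v → m < n) → (m <ᵇ n) ≡ (u <ᵇ v)
<ᵇ-≡ {m} {n} {u} {v} ⇒ ⇐ with u <? v
... | yes u<v = trans (<ᵇ-true (⇐ u<v)) (sym (<ᵇ-true u<v))
... | no  u≮v = trans (<ᵇ-false (≮⇒≥ (u≮v ∘ ⇒))) (sym (<ᵇ-false (≮⇒≥ u≮v)))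

≡ᵇ-true : ∀ {m n} → m ≡ n → (m ≡ᵇ n) ≡ true
≡ᵇ-true {m} {n} m≡n with m ≡ᵇ n | ≡⇒≡ᵇ m n m≡n
... | true | _ = refl

≡ᵇ-false : ∀ {m n} → m ≢ n → (m ≡ᵇ n) ≡ false
≡ᵇ-false {m} {n} m≢n with m ≡ᵇ n in eq
... | false = refl
... | true  = ⊥-elim (m≢n (≡ᵇ⇒≡ m n (subst T (sym eq) tt)))

∧-false : ∀ {a b} → a ≡ false → a ∧ b ≡ false
∧-false refl = refl

∧-true : ∀ {a b c} → a ≡ true → b ≡ c → a ∧ b ≡ c
∧-true refl b≡c = b≡c

indicator : Bool → ℕ
indicator true  = 1
indicator false = 0

countᵇ-∷ : ∀ {A : Set} (P : A → Bool) x xs → countᵇ P (x ∷ xs) ≡ indicator (P x) + countᵇ P xs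
countᵇ-∷ P x xs with P x
... | true  = refl
... | false = refl

countᵇ-++ : ∀ {A : Set} (P : A → Bool) xs ys → countᵇ P (xs ++ ys) ≡ countᵇ P xs + countᵇ P ys
countᵇ-++ P xs ys = trans (cong length (filter-++ (λ x → T? (P x)) xs ys)) (length-++ (filterᵇ P xs))

countᵇ-map : ∀ {A B : Set} (P : B → Bool) (f : A → B) xs → countᵇ P (map f xs) ≡ countᵇ (λ x → P (f x)) xs
countᵇ-map P f []       = refl
countᵇ-map P f (x ∷ xs) = trans (countᵇ-∷ P (f x) (map f xs))
  (trans (cong (indicator (P (f x)) +_) (countᵇ-map P f xs)) (sym (countᵇ-∷ (λ x → P (f x)) x xs)))

interval : ℕ → ℕ → List ℕ
interval a zero    = []
interval a (suc k) = a ∷ interval (suc a) k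

range1≡interval : ∀ n → range1 n ≡ interval 1 n
range1≡interval n = go n (λ i → i) 0 (λ _ → refl)
  where
  go : ∀ n (f : ℕ → ℕ) a → (∀ i → f i ≡ a + i) → map suc (applyUpTo f n) ≡ interval (suc a) n
  go zero    f a f≗a+ = refl
  go (suc n) f a f≗a+ = cong₂ _∷_ (cong suc (trans (f≗a+ 0) (+-identityʳ a)))
    (go n (λ i → f (suc i)) (suc a) (λ i → trans (f≗a+ (suc i)) (+-suc a i)))

interval-+ : ∀ a k l → interval a (k + l) ≡ interval a k ++ interval (a + k) l
interval-+ a zero    l = cong (λ b → interval b l) (sym (+-identityʳ a))
interval-+ a (suc k) l = cong (a ∷_) (trans (interval-+ (suc a) k l)
  (cong (λ b → interval (suc a) k ++ interval b l) (sym (+-suc a k))))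

length-interval : ∀ a k → length (interval a k) ≡ k
length-interval a zero    = refl
length-interval a (suc k) = cong suc (length-interval (suc a) k)

countᵇ-interval-+ : ∀ (P : ℕ → Bool) a k l →
  countᵇ P (interval a (k + l)) ≡ countᵇ P (interval a k) + countᵇ P (interval (a + k) l)
countᵇ-interval-+ P a k l = trans (cong (countᵇ P) (interval-+ a k l)) (countᵇ-++ P (interval a k) _)

countᵇ-interval-cong : ∀ (P Q : ℕ → Bool) a k → (∀ i → i < k → P (a + i) ≡ Q (a + i)) →
  countᵇ P (interval a k) ≡ countᵇ Q (interval a k)
countᵇ-interval-cong P Q a zero    P≗Q = refl
countᵇ-interval-cong P Q a (suc k) P≗Q = begin
  countᵇ P (interval a (suc k))                          ≡⟨ countᵇ-∷ P a _ ⟩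
  indicator (P a) + countᵇ P (interval (suc a) k)        ≡⟨ cong₂ _+_ (cong indicator head) tail ⟩
  indicator (Q a) + countᵇ Q (interval (suc a) k)        ≡⟨ countᵇ-∷ Q a _ ⟨
  countᵇ Q (interval a (suc k))                          ∎
  where
  open ≡-Reasoning
  shift : ∀ {i} → P (a + suc i) ≡ Q (a + suc i) → P (suc a + i) ≡ Q (suc a + i)
  shift {i} = subst (λ b → P b ≡ Q b) (+-suc a i)
  head : P a ≡ Q a
  head = subst (λ b → P b ≡ Q b) (+-identityʳ a) (P≗Q 0 z<s)
  tail : countᵇ P (interval (suc a) k) ≡ countᵇ Q (interval (suc a) k)
  tail = countᵇ-interval-cong P Q (suc a) k (λ i i<k → shift (P≗Q (suc i) (s<s i<k)))

countᵇ-const : ∀ {A : Set} (b : Bool) (xs : List A) → countᵇ (λ _ → b) xs ≡ indicator b * length xs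
countᵇ-const false []       = refl
countᵇ-const false (x ∷ xs) = countᵇ-const false xs
countᵇ-const true  []       = refl
countᵇ-const true  (x ∷ xs) = cong suc (countᵇ-const true xs)

countᵇ-interval-none : ∀ (P : ℕ → Bool) a k → (∀ i → i < k → P (a + i) ≡ false) →
  countᵇ P (interval a k) ≡ 0
countᵇ-interval-none P a k none =
  trans (countᵇ-interval-cong P (λ _ → false) a k none) (countᵇ-const false (interval a k))

countᵇ-interval-all : ∀ (P : ℕ → Bool) a k → (∀ i → i < k → P (a + i) ≡ true) →
  countᵇ P (interval a k) ≡ k
countᵇ-interval-all P a k all = begin
  countᵇ P (interval a k)               ≡⟨ countᵇ-interval-cong P (λ _ → true) a k all ⟩
  countᵇ (λ _ → true) (interval a k)    ≡⟨ countᵇ-const true (interval a k) ⟩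
  length (interval a k) + 0             ≡⟨ +-identityʳ _ ⟩
  length (interval a k)                 ≡⟨ length-interval a k ⟩
  k                                     ∎
  where open ≡-Reasoning

countᵇ-interval-+₃ : ∀ (P : ℕ → Bool) a k l o → countᵇ P (interval a (k + l + o)) ≡
  countᵇ P (interval a k) + countᵇ P (interval (a + k) l) + countᵇ P (interval (a + (k + l)) o)
countᵇ-interval-+₃ P a k l o =
  trans (countᵇ-interval-+ P a (k + l) o) (cong (_+ countᵇ P (interval (a + (k + l)) o)) (countᵇ-interval-+ P a k l))

module _ (P : ℕ → Bool) (a k l : ℕ) where

  private
    shift : ∀ {b} → (∀ i → k ≤ i → i < k + l → P (a + i) ≡ b) → ∀ i → i < l → P (a + k + i) ≡ b
    shift {b} hyp i i<l = subst (λ x → P x ≡ b) (sym (+-assoc a k i)) (hyp (k + i) (m≤m+n k i) (+-monoʳ-< k i<l))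

  countᵇ-segment-none : (∀ i → k ≤ i → i < k + l → P (a + i) ≡ false) → countᵇ P (interval (a + k) l) ≡ 0
  countᵇ-segment-none none = countᵇ-interval-none P (a + k) l (shift none)

  countᵇ-segment-all : (∀ i → k ≤ i → i < k + l → P (a + i) ≡ true) → countᵇ P (interval (a + k) l) ≡ l
  countᵇ-segment-all all = countᵇ-interval-all P (a + k) l (shift all)

countᵇ-interval-window : ∀ (P : ℕ → Bool) a k l o →
  (∀ i → i < k → P (a + i) ≡ false) →
  (∀ i → k ≤ i → i < k + l → P (a + i) ≡ true) →
  (∀ i → k + l ≤ i → i < k + l + o → P (a + i) ≡ false) →
  countᵇ P (interval a (k + l + o)) ≡ l
countᵇ-interval-window P a k l o before inside after = begin
  countᵇ P (interval a (k + l + o))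
    ≡⟨ countᵇ-interval-+₃ P a k l o ⟩
  countᵇ P (interval a k) + countᵇ P (interval (a + k) l) + countᵇ P (interval (a + (k + l)) o)
    ≡⟨ cong₂ _+_ (cong₂ _+_ (countᵇ-interval-none P a k before) (countᵇ-segment-all P a k l inside))
                 (countᵇ-segment-none P a (k + l) o after) ⟩
  l + 0
    ≡⟨ +-identityʳ l ⟩
  l ∎
  where open ≡-Reasoning

countᵇ-interval-point : ∀ (P : ℕ → Bool) a k e → e < k → (∀ i → i < k → i ≢ e → P (a + i) ≡ false) →
  countᵇ P (interval a k) ≡ indicator (P (a + e))
countᵇ-interval-point P a k e e<k others with m≤n⇒∃[o]m+o≡n e<k
... | t , refl = begin
  countᵇ P (interval a (suc e + t))
    ≡⟨ cong (λ l → countᵇ P (interval a l)) (sym (+-suc e t)) ⟩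
  countᵇ P (interval a (e + suc t))
    ≡⟨ countᵇ-interval-+ P a e (suc t) ⟩
  countᵇ P (interval a e) + countᵇ P (interval (a + e) (suc t))
    ≡⟨ cong₂ _+_ (countᵇ-interval-none P a e (λ i i<e → others i (<-trans i<e (s≤s (m≤m+n e t))) (<⇒≢ i<e)))
                 (countᵇ-∷ P (a + e) _) ⟩
  indicator (P (a + e)) + countᵇ P (interval (suc (a + e)) t)
    ≡⟨ cong (indicator (P (a + e)) +_) (countᵇ-interval-none P (suc (a + e)) t later) ⟩
  indicator (P (a + e)) + 0
    ≡⟨ +-identityʳ _ ⟩
  indicator (P (a + e)) ∎
  where
  open ≡-Reasoning
  later : ∀ i → i < t → P (suc (a + e) + i) ≡ false
  later i i<t = subst (λ b → P b ≡ false) (trans (sym (+-assoc a (suc e) i)) (cong (_+ i) (+-suc a e)))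
    (others (suc e + i) (+-monoʳ-< (suc e) i<t) (λ eq → <⇒≢ (m≤m+n (suc e) i) (sym eq)))

column : ℕ → (Cell → Bool) → ℕ → ℕ
column n P a = countᵇ (λ b → P (a , b)) (interval 1 n)

countᵇ-cells : ∀ n (P : Cell → Bool) → countᵇ P (cells n) ≡ column n P 1 + column n P 2 + column n P 3
countᵇ-cells n P rewrite range1≡interval n = begin
  countᵇ P (map (1 ,_) I ++ map (2 ,_) I ++ map (3 ,_) I ++ [])
    ≡⟨ countᵇ-++ P (map (1 ,_) I) _ ⟩
  countᵇ P (map (1 ,_) I) + countᵇ P (map (2 ,_) I ++ map (3 ,_) I ++ [])
    ≡⟨ cong (countᵇ P (map (1 ,_) I) +_) (countᵇ-++ P (map (2 ,_) I) _) ⟩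
  countᵇ P (map (1 ,_) I) + (countᵇ P (map (2 ,_) I) + countᵇ P (map (3 ,_) I ++ []))
    ≡⟨ cong (λ X → countᵇ P (map (1 ,_) I) + (countᵇ P (map (2 ,_) I) + countᵇ P X)) (++-identityʳ (map (3 ,_) I)) ⟩
  countᵇ P (map (1 ,_) I) + (countᵇ P (map (2 ,_) I) + countᵇ P (map (3 ,_) I))
    ≡⟨ sym (+-assoc (countᵇ P (map (1 ,_) I)) _ _) ⟩
  countᵇ P (map (1 ,_) I) + countᵇ P (map (2 ,_) I) + countᵇ P (map (3 ,_) I)
    ≡⟨ cong₂ _+_ (cong₂ _+_ (countᵇ-map P (1 ,_) I) (countᵇ-map P (2 ,_) I)) (countᵇ-map P (3 ,_) I) ⟩
  column n P 1 + column n P 2 + column n P 3 ∎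
  where
  open ≡-Reasoning
  I = interval 1 n

countᵇ-row : ∀ (Q : ℕ → Bool) n b → b < n → countᵇ (λ x → (x ≡ᵇ suc b) ∧ Q x) (interval 1 n) ≡ indicator (Q (suc b))
countᵇ-row Q n b b<n = trans
  (countᵇ-interval-point (λ x → (x ≡ᵇ suc b) ∧ Q x) 1 n b b<n (λ i _ i≢b → ∧-false (≡ᵇ-false (i≢b ∘ suc-injective))))
  (cong indicator (∧-true (≡ᵇ-true {b} refl) refl))

countᵇ-below : ∀ (Q : ℕ → Bool) n h l → h + l < n → (∀ i → Q (suc i) ≡ (h <ᵇ suc i)) →
  countᵇ (λ x → (x <ᵇ suc (h + l)) ∧ Q x) (interval 1 n) ≡ l
countᵇ-below Q n h l h+l<n Q≡ with m≤n⇒∃[o]m+o≡n h+l<n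
... | o , refl = trans (cong (λ k → countᵇ P (interval 1 k)) (sym (+-suc (h + l) o)))
  (countᵇ-interval-window P 1 h l (suc o)
    (λ i i<h → ∧-true (<ᵇ-true (≤-trans i<h (m≤m+n h l))) (trans (Q≡ i) (<ᵇ-false i<h)))
    (λ i h≤i i<h+l → ∧-true (<ᵇ-true i<h+l) (trans (Q≡ i) (<ᵇ-true (s≤s h≤i))))
    (λ i h+l≤i _ → ∧-false (<ᵇ-false h+l≤i)))
  where
  P : ℕ → Bool
  P x = (x <ᵇ suc (h + l)) ∧ Q x

repeat : ∀ {A : Set} → ℕ → List A → List A
repeat zero    X = []
repeat (suc k) X = X ++ repeat k X

module _ {A : Set} (B : ℕ → List A) where

  concatMap-interval-+ : ∀ a k l → concatMap B (interval a (k + l)) ≡ concatMap B (interval a k) ++ concatMap B (interval (a + k) l)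
  concatMap-interval-+ a zero    l = cong (λ b → concatMap B (interval b l)) (sym (+-identityʳ a))
  concatMap-interval-+ a (suc k) l = begin
    B a ++ concatMap B (interval (suc a) (k + l))
      ≡⟨ cong (B a ++_) (concatMap-interval-+ (suc a) k l) ⟩
    B a ++ concatMap B (interval (suc a) k) ++ concatMap B (interval (suc a + k) l)
      ≡⟨ cong (λ b → B a ++ concatMap B (interval (suc a) k) ++ concatMap B (interval b l)) (sym (+-suc a k)) ⟩
    B a ++ concatMap B (interval (suc a) k) ++ concatMap B (interval (a + suc k) l)
      ≡⟨ sym (++-assoc (B a) _ _) ⟩
    concatMap B (interval a (suc k)) ++ concatMap B (interval (a + suc k) l) ∎
    where open ≡-Reasoning

  concatMap-interval-+₃ : ∀ a k l o → concatMap B (interval a (k + l + o)) ≡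
    concatMap B (interval a k) ++ concatMap B (interval (a + k) l) ++ concatMap B (interval (a + (k + l)) o)
  concatMap-interval-+₃ a k l o = trans (concatMap-interval-+ a (k + l) o)
    (trans (cong (_++ concatMap B (interval (a + (k + l)) o)) (concatMap-interval-+ a k l))
           (++-assoc (concatMap B (interval a k)) _ _))

  concatMap-interval-const : ∀ a k X → (∀ i → i < k → B (a + i) ≡ X) → concatMap B (interval a k) ≡ repeat k X
  concatMap-interval-const a zero    X const = refl
  concatMap-interval-const a (suc k) X const = cong₂ _++_
    (subst (λ b → B b ≡ X) (+-identityʳ a) (const 0 z<s))
    (concatMap-interval-const (suc a) k X (λ i i<k → subst (λ b → B b ≡ X) (+-suc a i) (const (suc i) (s<s i<k))))

  concatMap-segment-const : ∀ a k l X → (∀ i → k ≤ i → i < k + l → B (a + i) ≡ X) →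
    concatMap B (interval (a + k) l) ≡ repeat l X
  concatMap-segment-const a k l X const = concatMap-interval-const (a + k) l X λ i i<l →
    subst (λ b → B b ≡ X) (sym (+-assoc a k i)) (const (k + i) (m≤m+n k i) (+-monoʳ-< k i<l))

  concatMap-interval-cong : ∀ (C : ℕ → List A) a k → (∀ i → i < k → B (a + i) ≡ C (a + i)) →
    concatMap B (interval a k) ≡ concatMap C (interval a k)
  concatMap-interval-cong C a zero    B≗C = refl
  concatMap-interval-cong C a (suc k) B≗C = cong₂ _++_
    (subst (λ b → B b ≡ C b) (+-identityʳ a) (B≗C 0 z<s))
    (concatMap-interval-cong C (suc a) k (λ i i<k → subst (λ b → B b ≡ C b) (+-suc a i) (B≗C (suc i) (s<s i<k))))

  concatMap-segment-cong : ∀ (C : ℕ → List A) a k l → (∀ i → k ≤ i → i < k + l → B (a + i) ≡ C (a + i)) →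
    concatMap B (interval (a + k) l) ≡ concatMap C (interval (a + k) l)
  concatMap-segment-cong C a k l B≗C = concatMap-interval-cong C (a + k) l λ i i<l →
    subst (λ b → B b ≡ C b) (sym (+-assoc a k i)) (B≗C (k + i) (m≤m+n k i) (+-monoʳ-< k i<l))

  concatMap-segment-[] : ∀ a k l → (∀ i → k ≤ i → i < k + l → B (a + i) ≡ []) → concatMap B (interval (a + k) l) ≡ []
  concatMap-segment-[] a k l empty = trans (concatMap-segment-cong (λ _ → []) a k l empty) (concat-[] (interval (a + k) l))
    where
    concat-[] : ∀ xs → concatMap {B = A} (λ _ → []) xs ≡ []
    concat-[] []       = refl
    concat-[] (x ∷ xs) = concat-[] xs

-- Paths with three east steps

-- The words with exactly three east steps; a Dyck path has l = 0.
lattice : ℕ → ℕ → ℕ → ℕ → List Step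
lattice i j k l = replicate i N ++ E ∷ replicate j N ++ E ∷ replicate k N ++ E ∷ replicate l N

path : ℕ → ℕ → ℕ → List Step
path i j k = lattice i j k 0

nBefore-replicate : ∀ i q k → nBefore (replicate i N ++ q) k ≡ i + nBefore q k
nBefore-replicate zero    q k = refl
nBefore-replicate (suc i) q k = cong suc (nBefore-replicate i q k)

height-path₁ : ∀ i j k → height (path i j k) 1 ≡ i
height-path₁ i j k = trans (nBefore-replicate i _ 0) (+-identityʳ i)

height-path₂ : ∀ i j k → height (path i j k) 2 ≡ i + j
height-path₂ i j k = trans (nBefore-replicate i _ 1) (cong (i +_) (trans (nBefore-replicate j _ 0) (+-identityʳ j)))

height-path₃ : ∀ i j k → height (path i j k) 3 ≡ i + j + k
height-path₃ i j k = begin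
  height (path i j k) 3                      ≡⟨ nBefore-replicate i _ 2 ⟩
  i + nBefore (replicate j N ++ E ∷ replicate k N ++ E ∷ []) 1 ≡⟨ cong (i +_) (nBefore-replicate j _ 1) ⟩
  i + (j + nBefore (replicate k N ++ E ∷ []) 0) ≡⟨ cong (λ x → i + (j + x)) (nBefore-replicate k _ 0) ⟩
  i + (j + (k + 0))                          ≡⟨ solve (i ∷ j ∷ k ∷ []) ⟩
  i + j + k                                  ∎
  where open ≡-Reasoning

#N-replicate : ∀ i → #N (replicate i N) ≡ i
#N-replicate zero    = refl
#N-replicate (suc i) = cong suc (#N-replicate i)

#N-run : ∀ i xs → #N (replicate i N ++ E ∷ xs) ≡ i + #N xs
#N-run zero    xs = refl
#N-run (suc i) xs = cong suc (#N-run i xs)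

#E-run : ∀ i xs → #E (replicate i N ++ E ∷ xs) ≡ suc (#E xs)
#E-run zero    xs = refl
#E-run (suc i) xs = #E-run i xs

#N-lattice : ∀ i j k l → #N (lattice i j k l) ≡ i + j + k + l
#N-lattice i j k l = begin
  #N (lattice i j k l)        ≡⟨ #N-run i _ ⟩
  i + #N (replicate j N ++ _) ≡⟨ cong (i +_) (#N-run j _) ⟩
  i + (j + #N (replicate k N ++ E ∷ replicate l N))
                              ≡⟨ cong (λ x → i + (j + x)) (#N-run k _) ⟩
  i + (j + (k + #N (replicate l N)))
                              ≡⟨ cong (λ x → i + (j + (k + x))) (#N-replicate l) ⟩
  i + (j + (k + l))           ≡⟨ solve (i ∷ j ∷ k ∷ l ∷ []) ⟩
  i + j + k + l               ∎
  where open ≡-Reasoning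

#E-path : ∀ i j k → #E (path i j k) ≡ 3
#E-path i j k = trans (#E-run i _) (cong suc (trans (#E-run j _) (cong suc (#E-run k []))))

allN : ∀ p → #E p ≡ 0 → p ≡ replicate (length p) N
allN []      _  = refl
allN (N ∷ p) p₀ = cong (N ∷_) (allN p p₀)

splitAtE : ∀ p e → #E p ≡ suc e → Σ ℕ λ i → Σ (List Step) λ q → p ≡ replicate i N ++ E ∷ q × #E q ≡ e
splitAtE (N ∷ p) e pₑ with splitAtE p e pₑ
... | i , q , refl , qₑ = suc i , q , refl , qₑ
splitAtE (E ∷ p) e pₑ = 0 , p , refl , suc-injective pₑ

threeEast⇒lattice : ∀ p → #E p ≡ 3 → Σ ℕ λ i → Σ ℕ λ j → Σ ℕ λ k → Σ ℕ λ l → p ≡ lattice i j k l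
threeEast⇒lattice p p₃ with splitAtE p 2 p₃
... | i , q , refl , q₂ with splitAtE q 1 q₂
... | j , q′ , refl , q′₁ with splitAtE q′ 0 q′₁
... | k , q″ , refl , q″₀ = i , j , k , length q″ ,
  cong (λ t → replicate i N ++ E ∷ replicate j N ++ E ∷ replicate k N ++ E ∷ t) (allN q″ q″₀)

take-length-++ : ∀ {A : Set} (xs ys : List A) → take (length xs) (xs ++ ys) ≡ xs
take-length-++ []       ys = refl
take-length-++ (x ∷ xs) ys = cong (x ∷_) (take-length-++ xs ys)

prefix-weaklyAbove : ∀ {n p} → IsDyck n p → ∀ q r → p ≡ q ++ r → n * #E q ≤ 3 * #N q
prefix-weaklyAbove {n} D q r refl =
  subst (λ t → n * #E t ≤ 3 * #N t) (take-length-++ q r) (IsDyck.weaklyAbove D (length q))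

run-++ : ∀ i xs ys → (replicate i N ++ E ∷ xs) ++ ys ≡ replicate i N ++ E ∷ (xs ++ ys)
run-++ i xs ys = ++-assoc (replicate i N) (E ∷ xs) ys

isDyck⇒path : ∀ n p → IsDyck n p → Σ ℕ λ i → Σ ℕ λ j → Σ ℕ λ k →
  p ≡ path i j k × i + j + k ≡ n × n ≤ 3 * i × 2 * n ≤ 3 * (i + j)
isDyck⇒path n p D with threeEast⇒lattice p (IsDyck.eastCount D)
... | i , j , k , l , refl = i , j , k , cong (lattice i j k) l≡0 , ijk≡n , above₁ , above₂
  where
  open ≡-Reasoning
  ijkl≡n : i + j + k + l ≡ n
  ijkl≡n = trans (sym (#N-lattice i j k l)) (IsDyck.northCount D)
  split₁ : lattice i j k l ≡ (replicate i N ++ E ∷ []) ++ (replicate j N ++ E ∷ replicate k N ++ E ∷ replicate l N)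
  split₁ = sym (run-++ i [] _)
  split₂ : lattice i j k l ≡ (replicate i N ++ E ∷ replicate j N ++ E ∷ []) ++ (replicate k N ++ E ∷ replicate l N)
  split₂ = sym (trans (run-++ i _ _) (cong (λ t → replicate i N ++ E ∷ t) (run-++ j [] _)))
  split₃ : lattice i j k l ≡ path i j k ++ replicate l N
  split₃ = sym (trans (run-++ i _ _) (cong (λ t → replicate i N ++ E ∷ t)
    (trans (run-++ j _ _) (cong (λ t → replicate j N ++ E ∷ t) (run-++ k [] _)))))
  aboveAt : ∀ q r → lattice i j k l ≡ q ++ r → ∀ {e h} → #E q ≡ e → #N q ≡ h → n * e ≤ 3 * h
  aboveAt q r split refl refl = prefix-weaklyAbove D q r split
  above₁ : n ≤ 3 * i
  above₁ = subst (_≤ 3 * i) (*-identityʳ n)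
    (aboveAt (replicate i N ++ E ∷ []) _ split₁ (#E-run i []) (trans (#N-run i []) (+-identityʳ i)))
  above₂ : 2 * n ≤ 3 * (i + j)
  above₂ = subst (_≤ 3 * (i + j)) (*-comm n 2)
    (aboveAt (replicate i N ++ E ∷ replicate j N ++ E ∷ []) _ split₂ (trans (#E-run i _) (cong suc (#E-run j [])))
                        (trans (#N-run i _) (cong (i +_) (trans (#N-run j []) (+-identityʳ j)))))
  above₃ : i + j + k + l ≤ i + j + k
  above₃ = *-cancelˡ-≤ 3 (subst (_≤ 3 * (i + j + k)) (trans (*-comm n 3) (cong (3 *_) (sym ijkl≡n)))
    (aboveAt (path i j k) _ split₃ (#E-path i j k) (trans (#N-lattice i j k 0) (+-identityʳ _))))
  l≡0 : l ≡ 0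
  l≡0 = n≤0⇒n≡0 (+-cancelˡ-≤ (i + j + k) l 0 (subst (i + j + k + l ≤_) (sym (+-identityʳ _)) above₃))
  ijk≡n : i + j + k ≡ n
  ijk≡n = trans (sym (+-identityʳ _)) (trans (cong (i + j + k +_) (sym l≡0)) ijkl≡n)

record AboveFrom (n e h : ℕ) (q : List Step) : Set where
  constructor aboveFrom
  field prefixAbove : ∀ k → n * (e + #E (take k q)) ≤ 3 * (h + #N (take k q))

aboveFrom-[] : ∀ {n e h} → n * e ≤ 3 * h → AboveFrom n e h []
aboveFrom-[] {n} {e} {h} start = aboveFrom λ where
  zero    → subst₂ (λ x y → n * x ≤ 3 * y) (sym (+-identityʳ e)) (sym (+-identityʳ h)) start
  (suc k) → subst₂ (λ x y → n * x ≤ 3 * y) (sym (+-identityʳ e)) (sym (+-identityʳ h)) start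

aboveFrom-N : ∀ {n e h q} → n * e ≤ 3 * h → AboveFrom n e (suc h) q → AboveFrom n e h (N ∷ q)
aboveFrom-N {n} {e} {h} {q} start (aboveFrom rest) = aboveFrom λ where
  zero    → subst₂ (λ x y → n * x ≤ 3 * y) (sym (+-identityʳ e)) (sym (+-identityʳ h)) start
  (suc k) → subst (λ y → n * (e + #E (take k q)) ≤ 3 * y) (sym (+-suc h _)) (rest k)

aboveFrom-E : ∀ {n e h q} → n * e ≤ 3 * h → AboveFrom n (suc e) h q → AboveFrom n e h (E ∷ q)
aboveFrom-E {n} {e} {h} {q} start (aboveFrom rest) = aboveFrom λ where
  zero    → subst₂ (λ x y → n * x ≤ 3 * y) (sym (+-identityʳ e)) (sym (+-identityʳ h)) start
  (suc k) → subst (λ x → n * x ≤ 3 * (h + #N (take k q))) (sym (+-suc e _)) (rest k)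

aboveFrom-replicate : ∀ {n e h q} c → AboveFrom n e (h + c) q → n * e ≤ 3 * h → AboveFrom n e h (replicate c N ++ q)
aboveFrom-replicate {n} {e} {h} {q} zero    rest start = subst (λ y → AboveFrom n e y q) (+-identityʳ h) rest
aboveFrom-replicate {n} {e} {h} {q} (suc c) rest start = aboveFrom-N start
  (aboveFrom-replicate c (subst (λ y → AboveFrom n e y q) (+-suc h c) rest) (≤-trans start (*-monoʳ-≤ 3 (n≤1+n h))))

path-isDyck : ∀ n i j k → i + j + k ≡ n → n ≤ 3 * i → 2 * n ≤ 3 * (i + j) → IsDyck n (path i j k)
path-isDyck n i j k ijk≡n above₁ above₂ = record
  { northCount  = trans (#N-lattice i j k 0) (trans (+-identityʳ _) ijk≡n)
  ; eastCount   = #E-path i j k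
  ; weaklyAbove = AboveFrom.prefixAbove fromOrigin
  }
  where
  origin : ∀ h → n * 0 ≤ 3 * h
  origin h = subst (_≤ 3 * h) (sym (*-zeroʳ n)) z≤n
  raise : ∀ {e} h c → n * e ≤ 3 * h → n * e ≤ 3 * (h + c)
  raise h c above = ≤-trans above (*-monoʳ-≤ 3 (m≤m+n h c))
  after₁ : n * 1 ≤ 3 * i
  after₁ = subst (_≤ 3 * i) (sym (*-identityʳ n)) above₁
  after₂ : n * 2 ≤ 3 * (i + j)
  after₂ = subst (_≤ 3 * (i + j)) (*-comm 2 n) above₂
  after₃ : n * 3 ≤ 3 * (i + j + k)
  after₃ = ≤-reflexive (trans (*-comm n 3) (cong (3 *_) (sym ijk≡n)))
  fromOrigin : AboveFrom n 0 0 (path i j k)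
  fromOrigin =
    aboveFrom-replicate i (aboveFrom-E (raise 0 i (origin 0))
    (aboveFrom-replicate j (aboveFrom-E (raise i j after₁)
    (aboveFrom-replicate k (aboveFrom-E (raise (i + j) k after₂)
    (aboveFrom-[] after₃)) after₂)) after₁)) (origin 0)

-- The line y = n x / 3 for n = 3m + 1 + r

3*+≤3*⇒< : ∀ q c b → 1 ≤ c → 3 * q + c ≤ 3 * b → q < b
3*+≤3*⇒< q c b 1≤c le with q <? b
... | yes q<b = q<b
... | no  q≮b = ⊥-elim (<⇒≱ (≤-<-trans (*-monoʳ-≤ 3 (≮⇒≥ q≮b)) (m<m+n (3 * q) 1≤c)) le)

<⇒3*+≤3* : ∀ q c b → c ≤ 3 → q < b → 3 * q + c ≤ 3 * b
<⇒3*+≤3* q c b c≤3 q<b = begin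
  3 * q + c  ≤⟨ +-monoʳ-≤ (3 * q) c≤3 ⟩
  3 * q + 3  ≡⟨ solve (q ∷ []) ⟩
  3 * suc q  ≤⟨ *-monoʳ-≤ 3 q<b ⟩
  3 * b      ∎
  where open ≤-Reasoning

3*+<ᵇ3* : ∀ q c b → c ≤ 2 → (3 * q + c <ᵇ 3 * b) ≡ (q <ᵇ b)
3*+<ᵇ3* q c b c≤2 = <ᵇ-≡
  (λ lt → 3*+≤3*⇒< q (suc c) b (s≤s z≤n) (subst (_≤ 3 * b) (sym (+-suc (3 * q) c)) lt))
  (λ lt → subst (_≤ 3 * b) (+-suc (3 * q) c) (<⇒3*+≤3* q (suc c) b (s≤s c≤2) lt))

3*<ᵇ3*+ : ∀ l q c → 1 ≤ c → c ≤ 3 → (3 * l <ᵇ 3 * q + c) ≡ (l <ᵇ suc q)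
3*<ᵇ3*+ l q c 1≤c c≤3 = <ᵇ-≡
  (λ lt → s≤s (≮⇒≥ (λ q<l → <⇒≱ lt (<⇒3*+≤3* q c l c≤3 q<l))))
  (λ lt → ≤-<-trans (*-monoʳ-≤ 3 (≤-pred lt)) (m<m+n (3 * q) 1≤c))

twice-3m+1+r : ∀ m r → r ≤ 1 → Σ ℕ λ c → c ≤ 1 × (3 * m + suc r) * 2 ≡ 3 * (m + m + r) + suc c
twice-3m+1+r m zero           _ = 1 , s≤s z≤n , solve (m ∷ [])
twice-3m+1+r m (suc zero)     _ = 0 , z≤n , solve (m ∷ [])
twice-3m+1+r m (suc (suc r)) (s≤s ())

module Line (m r : ℕ) (r≤1 : r ≤ 1) where

  n : ℕ
  n = 3 * m + suc r

  private
    r≤2 : r ≤ 2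
    r≤2 = ≤-trans r≤1 (s≤s z≤n)

  aboveLine₁ : ∀ b → aboveLine n (1 , suc b) ≡ (m <ᵇ b)
  aboveLine₁ b = trans (cong (_<ᵇ suc (3 * b)) (trans (*-identityʳ n) (+-suc (3 * m) r)))
    (3*+<ᵇ3* m r b r≤2)

  aboveLine₂ : ∀ b → aboveLine n (2 , suc b) ≡ (m + m + r <ᵇ b)
  aboveLine₂ b with twice-3m+1+r m r r≤1
  ... | c , c≤1 , twice = trans (cong (_<ᵇ suc (3 * b)) (trans twice (+-suc _ c)))
    (3*+<ᵇ3* (m + m + r) c b (≤-trans c≤1 (s≤s z≤n)))

  aboveLine₃ : ∀ b → b < n → aboveLine n (3 , suc b) ≡ false
  aboveLine₃ b b<n = <ᵇ-false (begin
    suc (3 * b)  ≡⟨ +-comm 1 (3 * b) ⟩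
    3 * b + 1    ≤⟨ <⇒3*+≤3* b 1 (suc b) (s≤s z≤n) ≤-refl ⟩
    3 * suc b    ≤⟨ *-monoʳ-≤ 3 b<n ⟩
    3 * n        ≡⟨ *-comm 3 n ⟩
    n * 3        ∎)
    where open ≤-Reasoning

  dinvCondition₀ : ∀ l → dinvCondition n 0 l ≡ (l <ᵇ suc m)
  dinvCondition₀ zero    = refl
  dinvCondition₀ (suc l) = trans (cong (3 * suc l <ᵇ_) (*-identityʳ n))
    (3*<ᵇ3*+ (suc l) m (suc r) (s≤s z≤n) (s≤s r≤2))

  3*<n*2 : ∀ l → l ≤ m + m + r → 3 * l < n * 2
  3*<n*2 l l≤ with twice-3m+1+r m r r≤1
  ... | c , _ , twice = begin-strict
    3 * l                    ≤⟨ *-monoʳ-≤ 3 l≤ ⟩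
    3 * (m + m + r)          <⟨ m<m+n _ (s≤s z≤n) ⟩
    3 * (m + m + r) + suc c  ≡⟨ twice ⟨
    n * 2                    ∎
    where open ≤-Reasoning

  dinvCondition₁ : ∀ l → l ≤ m + m + r → dinvCondition n 1 l ≡ (m <ᵇ suc l)
  dinvCondition₁ l l≤ = begin
    dinvCondition n 1 l
      ≡⟨ cong₂ _∧_ (cong (_<ᵇ 3 * suc l) (*-identityˡ n)) (cong ((l ≡ᵇ 0) ∨_) (<ᵇ-true (3*<n*2 l l≤))) ⟩
    (3 * m + suc r <ᵇ 3 * suc l) ∧ ((l ≡ᵇ 0) ∨ true)
      ≡⟨ cong₂ _∧_ (3*+<ᵇ3* m (suc r) (suc l) (s≤s r≤1)) (∨-zeroʳ (l ≡ᵇ 0)) ⟩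
    (m <ᵇ suc l) ∧ true
      ≡⟨ ∧-identityʳ _ ⟩
    (m <ᵇ suc l) ∎
    where open ≡-Reasoning

-- For n = 3m + 1 + r the line forces the first two east steps to heights at least
-- m + 1 and 2m + 1 + r; p₁ and p₂ are the excesses over these minima, g and y
-- the gaps between consecutive east steps from the second one on.
record Coordinates (m r : ℕ) : Set where
  field
    p₁ p₂ g y : ℕ
    p₂+y≡m      : p₂ + y ≡ m
    p₁+g≡m+r+p₂ : p₁ + g ≡ m + r + p₂

  toPath : List Step
  toPath = path (suc (m + p₁)) g y

  height₂≡ : suc (m + p₁) + g ≡ suc (m + m + r + p₂)
  height₂≡ = begin
    suc (m + p₁) + g   ≡⟨ cong suc (+-assoc m p₁ g) ⟩
    suc (m + (p₁ + g)) ≡⟨ cong (λ x → suc (m + x)) p₁+g≡m+r+p₂ ⟩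
    suc (m + (m + r + p₂)) ≡⟨ cong suc (trans (sym (+-assoc m (m + r) p₂)) (cong (_+ p₂) (sym (+-assoc m m r)))) ⟩
    suc (m + m + r + p₂) ∎
    where open ≡-Reasoning

  height₃≡ : suc (m + p₁) + g + y ≡ 3 * m + suc r
  height₃≡ = begin
    suc (m + p₁) + g + y       ≡⟨ cong (_+ y) height₂≡ ⟩
    suc (m + m + r + p₂) + y   ≡⟨ cong suc (+-assoc (m + m + r) p₂ y) ⟩
    suc (m + m + r + (p₂ + y)) ≡⟨ cong (λ x → suc (m + m + r + x)) p₂+y≡m ⟩
    suc (m + m + r + m)        ≡⟨ solve (m ∷ r ∷ []) ⟩
    3 * m + suc r              ∎
    where open ≡-Reasoning

  height-toPath₁ : height toPath 1 ≡ suc (m + p₁)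
  height-toPath₁ = height-path₁ _ g y

  height-toPath₂ : height toPath 2 ≡ suc (m + m + r + p₂)
  height-toPath₂ = trans (height-path₂ _ g y) height₂≡

  height-toPath₃ : height toPath 3 ≡ 3 * m + suc r
  height-toPath₃ = trans (height-path₃ _ g y) height₃≡

  toPath-isDyck : r ≤ 1 → IsDyck (3 * m + suc r) toPath
  toPath-isDyck r≤1 = path-isDyck _ _ g y height₃≡ above₁ above₂
    where
    open ≤-Reasoning
    above₁ : 3 * m + suc r ≤ 3 * suc (m + p₁)
    above₁ = <⇒3*+≤3* m (suc r) _ (s≤s (≤-trans r≤1 (s≤s z≤n))) (s≤s (m≤m+n m p₁))
    above₂ : 2 * (3 * m + suc r) ≤ 3 * (suc (m + p₁) + g)
    above₂ with twice-3m+1+r m r r≤1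
    ... | c , c≤1 , twice = begin
      2 * (3 * m + suc r)        ≡⟨ *-comm 2 (3 * m + suc r) ⟩
      (3 * m + suc r) * 2        ≡⟨ twice ⟩
      3 * (m + m + r) + suc c    ≤⟨ <⇒3*+≤3* (m + m + r) (suc c) _ (s≤s (≤-trans c≤1 (s≤s z≤n))) (s≤s (m≤m+n _ p₂)) ⟩
      3 * suc (m + m + r + p₂)   ≡⟨ cong (3 *_) (sym height₂≡) ⟩
      3 * (suc (m + p₁) + g)     ∎

  p₁+g+y≡m+m+r : p₁ + (g + y) ≡ m + m + r
  p₁+g+y≡m+m+r = begin
    p₁ + (g + y)     ≡⟨ sym (+-assoc p₁ g y) ⟩
    p₁ + g + y       ≡⟨ cong (_+ y) p₁+g≡m+r+p₂ ⟩
    m + r + p₂ + y   ≡⟨ +-assoc (m + r) p₂ y ⟩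
    m + r + (p₂ + y) ≡⟨ cong (m + r +_) p₂+y≡m ⟩
    m + r + m        ≡⟨ trans (+-assoc m r m) (trans (cong (m +_) (+-comm r m)) (sym (+-assoc m m r))) ⟩
    m + m + r        ∎
    where open ≡-Reasoning

  g+y≤m+m+r : g + y ≤ m + m + r
  g+y≤m+m+r = begin
    g + y                ≤⟨ m≤n+m (g + y) p₁ ⟩
    p₁ + (g + y)         ≡⟨ p₁+g+y≡m+m+r ⟩
    m + m + r            ∎
    where open ≤-Reasoning

  y≤m : y ≤ m
  y≤m = subst (y ≤_) p₂+y≡m (m≤n+m y p₂)

  p₂≤m : p₂ ≤ m
  p₂≤m = subst (p₂ ≤_) p₂+y≡m (m≤m+n p₂ y)

isDyck⇒coordinates : ∀ m r → r ≤ 1 → ∀ Π → IsDyck (3 * m + suc r) Π →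
  Σ (Coordinates m r) λ c → Π ≡ Coordinates.toPath c
isDyck⇒coordinates m r r≤1 Π D
  with isDyck⇒path _ Π D | twice-3m+1+r m r r≤1
... | i , j , k , refl , ijk≡n , above₁ , above₂ | c , _ , twice
  with m≤n⇒∃[o]m+o≡n (3*+≤3*⇒< m (suc r) i (s≤s z≤n) above₁)
     | m≤n⇒∃[o]m+o≡n (3*+≤3*⇒< (m + m + r) (suc c) (i + j) (s≤s z≤n) (subst (_≤ 3 * (i + j)) (trans (*-comm 2 (3 * m + suc r)) twice) above₂))
... | p₁ , refl | p₂ , i+j≡ = record
  { p₁ = p₁ ; p₂ = p₂ ; g = j ; y = k ; p₂+y≡m = p₂+k≡m ; p₁+g≡m+r+p₂ = p₁+j≡m+r+p₂ } , refl
  where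
  open ≡-Reasoning
  p₂+k≡m : p₂ + k ≡ m
  p₂+k≡m = +-cancelˡ-≡ (suc (m + m + r)) _ _ (begin
    suc (m + m + r) + (p₂ + k) ≡⟨ sym (+-assoc (suc (m + m + r)) p₂ k) ⟩
    suc (m + m + r) + p₂ + k   ≡⟨ cong (_+ k) i+j≡ ⟩
    suc (m + p₁) + j + k       ≡⟨ ijk≡n ⟩
    3 * m + suc r              ≡⟨ solve (m ∷ r ∷ []) ⟩
    suc (m + m + r) + m        ∎)
  p₁+j≡m+r+p₂ : p₁ + j ≡ m + r + p₂
  p₁+j≡m+r+p₂ = +-cancelˡ-≡ (suc m) _ _ (begin
    suc m + (p₁ + j)      ≡⟨ sym (+-assoc (suc m) p₁ j) ⟩
    suc (m + p₁) + j      ≡⟨ sym i+j≡ ⟩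
    suc (m + m + r) + p₂  ≡⟨ solve (m ∷ r ∷ p₂ ∷ []) ⟩
    suc m + (m + r + p₂)  ∎)

mkCoordinates : ∀ {m r} p₁ p₂ → p₂ ≤ m → p₁ ≤ m + r + p₂ → Coordinates m r
mkCoordinates p₁ p₂ p₂≤m p₁≤ with m≤n⇒∃[o]m+o≡n p₂≤m | m≤n⇒∃[o]m+o≡n p₁≤
... | y , p₂+y≡m | g , p₁+g≡ = record { p₁ = p₁ ; p₂ = p₂ ; g = g ; y = y ; p₂+y≡m = p₂+y≡m ; p₁+g≡m+r+p₂ = p₁+g≡ }

toPath-determined : ∀ {m r} (c c′ : Coordinates m r) → Coordinates.p₁ c ≡ Coordinates.p₁ c′ →
  Coordinates.p₂ c ≡ Coordinates.p₂ c′ → Coordinates.toPath c ≡ Coordinates.toPath c′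
toPath-determined {m} c c′ refl refl = cong₂ (path (suc (m + Coordinates.p₁ c))) g≡g′ y≡y′
  where
  module C = Coordinates c
  module C′ = Coordinates c′
  g≡g′ : C.g ≡ C′.g
  g≡g′ = +-cancelˡ-≡ C.p₁ _ _ (trans C.p₁+g≡m+r+p₂ (sym C′.p₁+g≡m+r+p₂))
  y≡y′ : C.y ≡ C′.y
  y≡y′ = +-cancelˡ-≡ C.p₂ _ _ (trans C.p₂+y≡m (sym C′.p₂+y≡m))

module Columns {m r : ℕ} (c : Coordinates m r) where
  open Coordinates c

  belowPath₁ : ∀ i → belowPath toPath (1 , suc i) ≡ (i <ᵇ suc (m + p₁))
  belowPath₁ i = cong (i <ᵇ_) height-toPath₁

  belowPath₂ : ∀ i → belowPath toPath (2 , suc i) ≡ (i <ᵇ suc (m + m + r + p₂))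
  belowPath₂ i = cong (i <ᵇ_) height-toPath₂

  belowPath₃ : ∀ i → i < 3 * m + suc r → belowPath toPath (3 , suc i) ≡ true
  belowPath₃ i i<n = trans (cong (i <ᵇ_) height-toPath₃) (<ᵇ-true i<n)

  inLambda₁ : ∀ i → inLambda toPath (1 , suc i) ≡ (m + p₁ <ᵇ i)
  inLambda₁ i = cong (_<ᵇ suc i) height-toPath₁

  inLambda₂ : ∀ i → inLambda toPath (2 , suc i) ≡ (m + m + r + p₂ <ᵇ i)
  inLambda₂ i = cong (_<ᵇ suc i) height-toPath₂

  inLambda₃ : ∀ i → i < 3 * m + suc r → inLambda toPath (3 , suc i) ≡ false
  inLambda₃ i i<n = trans (cong (_<ᵇ suc i) height-toPath₃) (<ᵇ-false i<n)

module _ {m r : ℕ} where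

  regionI⇒m<g : ∀ (c : Coordinates m r) → suc (Coordinates.p₁ c) ≤ r + Coordinates.p₂ c → m < Coordinates.g c
  regionI⇒m<g record { p₁ = p₁ ; p₂ = p₂ ; g = g ; p₁+g≡m+r+p₂ = p₁+g≡ } p₁<r+p₂ = +-cancelˡ-≤ p₁ (suc m) g (begin
    p₁ + suc m      ≡⟨ solve (p₁ ∷ m ∷ []) ⟩
    suc p₁ + m      ≤⟨ +-monoˡ-≤ m p₁<r+p₂ ⟩
    r + p₂ + m      ≡⟨ solve (r ∷ p₂ ∷ m ∷ []) ⟩
    m + r + p₂      ≡⟨ p₁+g≡ ⟨
    p₁ + g          ∎)
    where open ≤-Reasoning

  regionII⇒g≤m : ∀ (c : Coordinates m r) → r + Coordinates.p₂ c ≤ Coordinates.p₁ c → Coordinates.g c ≤ m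
  regionII⇒g≤m record { p₁ = p₁ ; p₂ = p₂ ; g = g ; p₁+g≡m+r+p₂ = p₁+g≡ } r+p₂≤p₁ = +-cancelˡ-≤ p₁ g m (begin
    p₁ + g          ≡⟨ p₁+g≡ ⟩
    m + r + p₂      ≡⟨ +-assoc m r p₂ ⟩
    m + (r + p₂)    ≤⟨ +-monoʳ-≤ m r+p₂≤p₁ ⟩
    m + p₁          ≡⟨ +-comm m p₁ ⟩
    p₁ + m          ∎)
    where open ≤-Reasoning

  regionII⇒m<g+y : ∀ (c : Coordinates m r) → suc (Coordinates.p₁ c) ≤ r + m → m < Coordinates.g c + Coordinates.y c
  regionII⇒m<g+y c p₁<r+m = +-cancelˡ-≤ (Coordinates.p₁ c) (suc m) _ (begin
    p₁ + suc m        ≡⟨ +-suc p₁ m ⟩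
    suc p₁ + m        ≤⟨ +-monoˡ-≤ m p₁<r+m ⟩
    r + m + m         ≡⟨ trans (+-assoc r m m) (+-comm r (m + m)) ⟩
    m + m + r         ≡⟨ p₁+g+y≡m+m+r ⟨
    p₁ + (g + y)      ∎)
    where
    open ≤-Reasoning
    open Coordinates c

  regionIII⇒g+y≤m : ∀ (c : Coordinates m r) → r + m ≤ Coordinates.p₁ c → Coordinates.g c + Coordinates.y c ≤ m
  regionIII⇒g+y≤m c r+m≤p₁ = +-cancelʳ-≤ (r + m) _ m (begin
    g + y + (r + m)   ≤⟨ +-monoʳ-≤ (g + y) r+m≤p₁ ⟩
    g + y + p₁        ≡⟨ +-comm (g + y) p₁ ⟩
    p₁ + (g + y)      ≡⟨ p₁+g+y≡m+m+r ⟩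
    m + m + r         ≡⟨ trans (+-assoc m m r) (cong (m +_) (+-comm m r)) ⟩
    m + (r + m)       ∎)
    where
    open ≤-Reasoning
    open Coordinates c

-- area

module _ {m r : ℕ} (r≤1 : r ≤ 1) (c : Coordinates m r) where
  open Coordinates c
  open Columns c
  open Line m r r≤1

  private
    P : Cell → Bool
    P x = belowPath toPath x ∧ aboveLine n x

  area-column₁ : column n P 1 ≡ p₁
  area-column₁ = trans (cong (λ l → countᵇ (λ b → P (1 , b)) (interval 1 l)) n≡)
    (countᵇ-interval-window (λ b → P (1 , b)) 1 (suc m) p₁ (g + y)
      (λ i i<1+m → ∧-true (below i (≤-trans i<1+m (s≤s (m≤m+n m p₁)))) (trans (aboveLine₁ i) (<ᵇ-false (≤-pred i<1+m))))
      (λ i 1+m≤i i< → ∧-true (below i i<) (trans (aboveLine₁ i) (<ᵇ-true 1+m≤i)))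
      (λ i ≤i _ → ∧-false (trans (belowPath₁ i) (<ᵇ-false ≤i))))
    where
    below : ∀ i → i < suc (m + p₁) → belowPath toPath (1 , suc i) ≡ true
    below i lt = trans (belowPath₁ i) (<ᵇ-true lt)
    n≡ : n ≡ suc m + p₁ + (g + y)
    n≡ = trans (sym height₃≡) (+-assoc (suc m + p₁) g y)

  area-column₂ : column n P 2 ≡ p₂
  area-column₂ = trans (cong (λ l → countᵇ (λ b → P (2 , b)) (interval 1 l)) n≡)
    (countᵇ-interval-window (λ b → P (2 , b)) 1 (suc (m + m + r)) p₂ y
      (λ i i<k → ∧-true (below i (≤-trans i<k (s≤s (m≤m+n _ p₂)))) (trans (aboveLine₂ i) (<ᵇ-false (≤-pred i<k))))
      (λ i k≤i i< → ∧-true (below i i<) (trans (aboveLine₂ i) (<ᵇ-true k≤i)))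
      (λ i ≤i _ → ∧-false (trans (belowPath₂ i) (<ᵇ-false ≤i))))
    where
    below : ∀ i → i < suc (m + m + r + p₂) → belowPath toPath (2 , suc i) ≡ true
    below i lt = trans (belowPath₂ i) (<ᵇ-true lt)
    n≡ : n ≡ suc (m + m + r) + p₂ + y
    n≡ = trans (sym height₃≡) (cong (_+ y) height₂≡)

  area-column₃ : column n P 3 ≡ 0
  area-column₃ = countᵇ-interval-none (λ b → P (3 , b)) 1 n
    (λ i i<n → ∧-true (belowPath₃ i i<n) (aboveLine₃ i i<n))

  area-toPath : area n toPath ≡ p₁ + p₂
  area-toPath = begin
    area n toPath                                    ≡⟨ countᵇ-cells n P ⟩
    column n P 1 + column n P 2 + column n P 3       ≡⟨ cong₂ _+_ (cong₂ _+_ area-column₁ area-column₂) area-column₃ ⟩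
    p₁ + p₂ + 0                                      ≡⟨ +-identityʳ _ ⟩
    p₁ + p₂                                          ∎
    where open ≡-Reasoning

-- arm, leg and dinv

module _ {m r : ℕ} (r≤1 : r ≤ 1) (c : Coordinates m r) where
  open Coordinates c
  open Columns c
  open Line m r r≤1
  open ≡-Reasoning

  h₁ h₂ : ℕ
  h₁ = suc (m + p₁)
  h₂ = suc (m + m + r + p₂)

  arm₁ : ∀ b → b < n → arm n toPath (1 , suc b) ≡ indicator (inLambda toPath (2 , suc b))
  arm₁ b b<n = begin
    arm n toPath (1 , suc b)
      ≡⟨ countᵇ-cells n _ ⟩
    column n P 1 + column n P 2 + column n P 3
      ≡⟨ cong₂ _+_ (cong₂ _+_ (countᵇ-interval-none _ 1 n (λ _ _ → refl)) (countᵇ-row (λ x → inLambda toPath (2 , x)) n b b<n))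
                   (countᵇ-row (λ x → inLambda toPath (3 , x)) n b b<n) ⟩
    indicator (inLambda toPath (2 , suc b)) + indicator (inLambda toPath (3 , suc b))
      ≡⟨ cong (λ x → indicator (inLambda toPath (2 , suc b)) + indicator x) (inLambda₃ b b<n) ⟩
    indicator (inLambda toPath (2 , suc b)) + 0
      ≡⟨ +-identityʳ _ ⟩
    indicator (inLambda toPath (2 , suc b)) ∎
    where
    P : Cell → Bool
    P x = (1 <ᵇ proj₁ x) ∧ ((proj₂ x ≡ᵇ suc b) ∧ inLambda toPath x)

  arm₂ : ∀ b → b < n → arm n toPath (2 , suc b) ≡ 0
  arm₂ b b<n = begin
    arm n toPath (2 , suc b)
      ≡⟨ countᵇ-cells n _ ⟩
    column n P 1 + column n P 2 + column n P 3
      ≡⟨ cong₂ _+_ (cong₂ _+_ (countᵇ-interval-none _ 1 n (λ _ _ → refl)) (countᵇ-interval-none _ 1 n (λ _ _ → refl)))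
                   (countᵇ-row (λ x → inLambda toPath (3 , x)) n b b<n) ⟩
    indicator (inLambda toPath (3 , suc b))
      ≡⟨ cong indicator (inLambda₃ b b<n) ⟩
    0 ∎
    where
    P : Cell → Bool
    P x = (2 <ᵇ proj₁ x) ∧ ((proj₂ x ≡ᵇ suc b) ∧ inLambda toPath x)

  leg₁ : ∀ l → h₁ + l < n → leg n toPath (1 , suc (h₁ + l)) ≡ l
  leg₁ l h₁+l<n = begin
    leg n toPath (1 , suc (h₁ + l))
      ≡⟨ countᵇ-cells n _ ⟩
    column n P 1 + column n P 2 + column n P 3
      ≡⟨ cong₂ _+_ (cong₂ _+_ (countᵇ-below (λ x → inLambda toPath (1 , x)) n h₁ l h₁+l<n inLambda₁)
                              (countᵇ-interval-none _ 1 n (λ _ _ → refl)))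
                   (countᵇ-interval-none _ 1 n (λ _ _ → refl)) ⟩
    l + 0 + 0
      ≡⟨ +-identityʳ _ ⟩
    l + 0
      ≡⟨ +-identityʳ l ⟩
    l ∎
    where
    P : Cell → Bool
    P x = (proj₁ x ≡ᵇ 1) ∧ ((proj₂ x <ᵇ suc (h₁ + l)) ∧ inLambda toPath x)

  leg₂ : ∀ l → h₂ + l < n → leg n toPath (2 , suc (h₂ + l)) ≡ l
  leg₂ l h₂+l<n = begin
    leg n toPath (2 , suc (h₂ + l))
      ≡⟨ countᵇ-cells n _ ⟩
    column n P 1 + column n P 2 + column n P 3
      ≡⟨ cong₂ _+_ (cong₂ _+_ (countᵇ-interval-none _ 1 n (λ _ _ → refl))
                              (countᵇ-below (λ x → inLambda toPath (2 , x)) n h₂ l h₂+l<n inLambda₂))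
                   (countᵇ-interval-none _ 1 n (λ _ _ → refl)) ⟩
    0 + l + 0
      ≡⟨ +-identityʳ l ⟩
    l ∎
    where
    P : Cell → Bool
    P x = (proj₁ x ≡ᵇ 2) ∧ ((proj₂ x <ᵇ suc (h₂ + l)) ∧ inLambda toPath x)

  D : Cell → Bool
  D x = inLambda toPath x ∧ dinvCondition n (arm n toPath x) (leg n toPath x)

  private
    h₁+l<n : ∀ {l} → l < g + y → h₁ + l < n
    h₁+l<n {l} l< = subst (h₁ + l <_) (trans (sym (+-assoc h₁ g y)) height₃≡) (+-monoʳ-< h₁ l<)

    inLambda₁-after : ∀ l → inLambda toPath (1 , suc (h₁ + l)) ≡ true
    inLambda₁-after l = trans (inLambda₁ (h₁ + l)) (<ᵇ-true (s≤s (m≤m+n (m + p₁) l)))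

    inLambda₂-at : ∀ l → inLambda toPath (2 , suc (h₁ + l)) ≡ (g <ᵇ suc l)
    inLambda₂-at l = trans (cong (_<ᵇ suc (h₁ + l)) (trans height-toPath₂ (sym height₂≡)))
      (<ᵇ-≡ (λ lt → s≤s (+-cancelˡ-≤ h₁ g l (≤-pred lt))) (λ lt → s≤s (+-monoʳ-≤ h₁ (≤-pred lt))))

  dinv-column₁-short : ∀ l → l < g → D (1 , suc (h₁ + l)) ≡ (l <ᵇ suc m)
  dinv-column₁-short l l<g = begin
    D (1 , suc (h₁ + l))
      ≡⟨ ∧-true (inLambda₁-after l) refl ⟩
    dinvCondition n (arm n toPath (1 , suc (h₁ + l))) (leg n toPath (1 , suc (h₁ + l)))
      ≡⟨ cong₂ (dinvCondition n) (trans (arm₁ (h₁ + l) l<n) (cong indicator (trans (inLambda₂-at l) (<ᵇ-false l<g)))) (leg₁ l l<n) ⟩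
    dinvCondition n 0 l
      ≡⟨ dinvCondition₀ l ⟩
    (l <ᵇ suc m) ∎
    where l<n = h₁+l<n (≤-trans l<g (m≤m+n g y))

  dinv-column₁-long : ∀ l → g ≤ l → l < g + y → D (1 , suc (h₁ + l)) ≡ (m <ᵇ suc l)
  dinv-column₁-long l g≤l l<g+y = begin
    D (1 , suc (h₁ + l))
      ≡⟨ ∧-true (inLambda₁-after l) refl ⟩
    dinvCondition n (arm n toPath (1 , suc (h₁ + l))) (leg n toPath (1 , suc (h₁ + l)))
      ≡⟨ cong₂ (dinvCondition n) (trans (arm₁ (h₁ + l) l<n) (cong indicator (trans (inLambda₂-at l) (<ᵇ-true (s≤s g≤l))))) (leg₁ l l<n) ⟩
    dinvCondition n 1 l
      ≡⟨ dinvCondition₁ l (≤-trans (<⇒≤ l<g+y) g+y≤m+m+r) ⟩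
    (m <ᵇ suc l) ∎
    where l<n = h₁+l<n l<g+y

  dinv₁ : ℕ
  dinv₁ = countᵇ (λ b → D (1 , b)) (interval (suc h₁) (g + y))

  dinv-column₁ : column n D 1 ≡ dinv₁
  dinv-column₁ = begin
    countᵇ D₁ (interval 1 n)
      ≡⟨ cong (λ k → countᵇ D₁ (interval 1 k)) (trans (sym height₃≡) (+-assoc h₁ g y)) ⟩
    countᵇ D₁ (interval 1 (h₁ + (g + y)))
      ≡⟨ countᵇ-interval-+ D₁ 1 h₁ (g + y) ⟩
    countᵇ D₁ (interval 1 h₁) + dinv₁
      ≡⟨ cong (_+ dinv₁) (countᵇ-interval-none D₁ 1 h₁ (λ i i<h₁ → ∧-false (trans (inLambda₁ i) (<ᵇ-false (≤-pred i<h₁))))) ⟩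
    dinv₁ ∎
    where
    D₁ : ℕ → Bool
    D₁ b = D (1 , b)

  dinv-column₂ : column n D 2 ≡ y
  dinv-column₂ = begin
    countᵇ D₂ (interval 1 n)
      ≡⟨ cong (λ k → countᵇ D₂ (interval 1 k)) (trans (sym height₃≡) (cong (_+ y) height₂≡)) ⟩
    countᵇ D₂ (interval 1 (h₂ + y))
      ≡⟨ countᵇ-interval-+ D₂ 1 h₂ y ⟩
    countᵇ D₂ (interval 1 h₂) + countᵇ D₂ (interval (suc h₂) y)
      ≡⟨ cong₂ _+_ (countᵇ-interval-none D₂ 1 h₂ (λ i i<h₂ → ∧-false (trans (inLambda₂ i) (<ᵇ-false (≤-pred i<h₂)))))
                   (countᵇ-interval-all D₂ (suc h₂) y cell) ⟩
    y ∎
    where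
    D₂ : ℕ → Bool
    D₂ b = D (2 , b)
    h₂+l<n : ∀ {l} → l < y → h₂ + l < n
    h₂+l<n {l} l<y = subst (h₂ + l <_) (trans (cong (_+ y) (sym height₂≡)) height₃≡) (+-monoʳ-< h₂ l<y)
    cell : ∀ l → l < y → D₂ (suc h₂ + l) ≡ true
    cell l l<y = ∧-true (trans (inLambda₂ (h₂ + l)) (<ᵇ-true (s≤s (m≤m+n (m + m + r + p₂) l))))
      (trans (cong₂ (dinvCondition n) (arm₂ (h₂ + l) (h₂+l<n l<y)) (leg₂ l (h₂+l<n l<y)))
             (trans (dinvCondition₀ l) (<ᵇ-true (s≤s (≤-trans (<⇒≤ l<y) y≤m)))))

  dinv-column₃ : column n D 3 ≡ 0
  dinv-column₃ = countᵇ-interval-none _ 1 n (λ i i<n → ∧-false (inLambda₃ i i<n))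

  dinv-toPath : dinv n toPath ≡ dinv₁ + y
  dinv-toPath = begin
    dinv n toPath                               ≡⟨ countᵇ-cells n D ⟩
    column n D 1 + column n D 2 + column n D 3  ≡⟨ cong₂ _+_ (cong₂ _+_ dinv-column₁ dinv-column₂) dinv-column₃ ⟩
    dinv₁ + y + 0                               ≡⟨ +-identityʳ _ ⟩
    dinv₁ + y                                   ∎

  private
    D₁ : ℕ → Bool
    D₁ b = D (1 , b)

    short-≤m : ∀ {i} → i < g → i ≤ m → D₁ (suc h₁ + i) ≡ true
    short-≤m {i} i<g i≤m = trans (dinv-column₁-short i i<g) (<ᵇ-true (s≤s i≤m))

    long-≥m : ∀ {i} → g ≤ i → i < g + y → m ≤ i → D₁ (suc h₁ + i) ≡ true
    long-≥m {i} g≤i i<g+y m≤i = trans (dinv-column₁-long i g≤i i<g+y) (<ᵇ-true (s≤s m≤i))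

    long-<m : ∀ {i} → g ≤ i → i < g + y → i < m → D₁ (suc h₁ + i) ≡ false
    long-<m {i} g≤i i<g+y i<m = trans (dinv-column₁-long i g≤i i<g+y) (<ᵇ-false i<m)

  dinv₁-short : g + y ≤ m → dinv₁ ≡ g
  dinv₁-short g+y≤m = begin
    dinv₁
      ≡⟨ countᵇ-interval-+ D₁ (suc h₁) g y ⟩
    countᵇ D₁ (interval (suc h₁) g) + countᵇ D₁ (interval (suc h₁ + g) y)
      ≡⟨ cong₂ _+_ (countᵇ-interval-all D₁ (suc h₁) g (λ i i<g → short-≤m i<g (≤-trans (<⇒≤ i<g) g≤m)))
                   (countᵇ-segment-none D₁ (suc h₁) g y (λ i g≤i i<g+y → long-<m g≤i i<g+y (<-≤-trans i<g+y g+y≤m))) ⟩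
    g + 0
      ≡⟨ +-identityʳ g ⟩
    g ∎
    where g≤m = ≤-trans (m≤m+n g y) g+y≤m

  dinv₁-long : m < g → dinv₁ ≡ suc m + y
  dinv₁-long m<g with m≤n⇒∃[o]m+o≡n m<g
  ... | g′ , 1+m+g′≡g = begin
    dinv₁
      ≡⟨ cong (λ k → countᵇ D₁ (interval (suc h₁) (k + y))) (sym 1+m+g′≡g) ⟩
    countᵇ D₁ (interval (suc h₁) (suc m + g′ + y))
      ≡⟨ trans (countᵇ-interval-+₃ D₁ (suc h₁) (suc m) g′ y) (cong₂ _+_ (cong₂ _+_
           (countᵇ-interval-all D₁ (suc h₁) (suc m) (λ i i≤m → short-≤m (<-≤-trans i≤m m<g) (≤-pred i≤m)))
           (countᵇ-segment-none D₁ (suc h₁) (suc m) g′ (λ i m<i i<g → trans (dinv-column₁-short i (g-bound i<g)) (<ᵇ-false m<i))))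
           (countᵇ-segment-all D₁ (suc h₁) (suc m + g′) y (λ i g≤i i<g+y →
             long-≥m (g-bound′ g≤i) (subst (λ k → i < k + y) 1+m+g′≡g i<g+y) (≤-trans (n≤1+n m) (≤-trans (m≤m+n (suc m) g′) g≤i))))) ⟩
    suc m + 0 + y
      ≡⟨ cong (_+ y) (+-identityʳ (suc m)) ⟩
    suc m + y ∎
    where
    g-bound : ∀ {i} → i < suc m + g′ → i < g
    g-bound {i} = subst (i <_) 1+m+g′≡g
    g-bound′ : ∀ {i} → suc m + g′ ≤ i → g ≤ i
    g-bound′ {i} = subst (_≤ i) 1+m+g′≡g

  dinv₁-middle : ∀ e f → g + e ≡ m → g + y ≡ m + f → dinv₁ ≡ g + f
  dinv₁-middle e f g+e≡m g+y≡m+f = begin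
    dinv₁
      ≡⟨ cong (λ k → countᵇ D₁ (interval (suc h₁) k)) g+y≡g+e+f ⟩
    countᵇ D₁ (interval (suc h₁) (g + e + f))
      ≡⟨ trans (countᵇ-interval-+₃ D₁ (suc h₁) g e f) (cong₂ _+_ (cong₂ _+_
           (countᵇ-interval-all D₁ (suc h₁) g (λ i i<g → short-≤m i<g (≤-trans (<⇒≤ i<g) (subst (g ≤_) g+e≡m (m≤m+n g e)))))
           (countᵇ-segment-none D₁ (suc h₁) g e (λ i g≤i i<g+e →
             long-<m g≤i (below-g+y (≤-trans i<g+e (m≤m+n (g + e) f))) (subst (i <_) g+e≡m i<g+e))))
           (countᵇ-segment-all D₁ (suc h₁) (g + e) f (λ i g+e≤i i<g+e+f →
             long-≥m (≤-trans (m≤m+n g e) g+e≤i) (below-g+y i<g+e+f) (subst (_≤ i) g+e≡m g+e≤i)))) ⟩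
    g + 0 + f
      ≡⟨ cong (_+ f) (+-identityʳ g) ⟩
    g + f ∎
    where
    g+y≡g+e+f : g + y ≡ g + e + f
    g+y≡g+e+f = trans g+y≡m+f (cong (_+ f) (sym g+e≡m))
    below-g+y : ∀ {i} → i < g + e + f → i < g + y
    below-g+y {i} = subst (i <_) (sym g+y≡g+e+f)

-- Skips of a word of marks

-- One pass over the marks: `seen` records a boxed entry so far, `inGap` an unboxed entry
-- since the last boxed one; a skip is counted when a boxed entry closes such a gap.
skipsFrom : Bool → Bool → List Bool → ℕ
skipsFrom seen inGap []          = 0
skipsFrom seen inGap (true ∷ L)  = indicator (seen ∧ inGap) + skipsFrom true false L
skipsFrom seen inGap (false ∷ L) = skipsFrom seen true L

indicator-∧-false : ∀ s → indicator (s ∧ false) ≡ 0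
indicator-∧-false true  = refl
indicator-∧-false false = refl

private
  any-collapse-true : ∀ L → any (λ z → z) (collapse (true ∷ L)) ≡ true
  any-collapse-true []          = refl
  any-collapse-true (true ∷ L)  = any-collapse-true L
  any-collapse-true (false ∷ L) = refl

  countSkips-true : ∀ s L → countSkips s (collapse (true ∷ L)) ≡ countSkips true (collapse L)
  countSkips-true s []          = refl
  countSkips-true s (true ∷ L)  = trans (countSkips-true s L) (sym (countSkips-true true L))
  countSkips-true s (false ∷ L) = refl

countSkips≡skipsFrom : ∀ s L → countSkips s (collapse L) ≡ skipsFrom s false L
countSkips-false≡skipsFrom : ∀ s L → countSkips s (collapse (false ∷ L)) ≡ skipsFrom s true L
countSkips≡skipsFrom s []          = refl
countSkips≡skipsFrom s (true ∷ L)  = trans (countSkips-true s L)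
  (trans (countSkips≡skipsFrom true L) (cong (_+ skipsFrom true false L) (sym (indicator-∧-false s))))
countSkips≡skipsFrom s (false ∷ L) = countSkips-false≡skipsFrom s L
countSkips-false≡skipsFrom true  []          = refl
countSkips-false≡skipsFrom false []          = refl
countSkips-false≡skipsFrom s     (true ∷ L)  =
  cong₂ _+_ (closes s) (trans (countSkips-true s L) (countSkips≡skipsFrom true L))
  where
  closes : ∀ s → (if s ∧ any (λ z → z) (collapse (true ∷ L)) then 1 else 0) ≡ indicator (s ∧ true)
  closes true  = cong (λ b → if b then 1 else 0) (any-collapse-true L)
  closes false = refl
countSkips-false≡skipsFrom s     (false ∷ L) = countSkips-false≡skipsFrom s L

FF FT TF TT : List Bool
FF = false ∷ false ∷ []
FT = false ∷ true ∷ []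
TF = true ∷ false ∷ []
TT = true ∷ true ∷ []

skipsFrom-unseen : ∀ b L → skipsFrom false b L ≡ skipsFrom false false L
skipsFrom-unseen b []          = refl
skipsFrom-unseen b (true ∷ L)  = refl
skipsFrom-unseen b (false ∷ L) = refl

skips-FF-unseen : ∀ a L → skipsFrom false false (repeat a FF ++ L) ≡ skipsFrom false false L
skips-FF-unseen zero    L = refl
skips-FF-unseen (suc a) L = trans (skipsFrom-unseen true (repeat a FF ++ L)) (skips-FF-unseen a L)

skips-F : ∀ s b f L → skipsFrom s b (repeat (suc f) (false ∷ []) ++ L) ≡ skipsFrom s true L
skips-F s b zero    L = refl
skips-F s b (suc f) L = skips-F s true f L

skips-FT : ∀ d L → skipsFrom true false (repeat d FT ++ L) ≡ d + skipsFrom true false L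
skips-FT zero    L = refl
skips-FT (suc d) L = cong suc (skips-FT d L)

skips-TF : ∀ d L → skipsFrom true true (repeat d TF ++ L) ≡ d + skipsFrom true true L
skips-TF zero    L = refl
skips-TF (suc d) L = cong suc (skips-TF d L)

skips-trues : ∀ s e k → skipsFrom s false (repeat e TT ++ repeat k (true ∷ [])) ≡ 0
skips-trues s (suc e) k    = trans (cong (_+ skipsFrom true false (true ∷ repeat e TT ++ repeat k (true ∷ [])))
  (indicator-∧-false s)) (skips-trues true e k)
skips-trues s zero (suc k) = trans (cong (_+ skipsFrom true false (repeat k (true ∷ [])))
  (indicator-∧-false s)) (skips-trues true 0 k)
skips-trues s zero zero    = refl

skips-closing : ∀ e k → skipsFrom true true (repeat e TT ++ repeat (suc k) (true ∷ [])) ≡ 1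
skips-closing zero    k = cong suc (skips-trues true 0 k)
skips-closing (suc e) k = cong suc (skips-trues true e (suc k))

skips-FF-FT-TT-T : ∀ a d e k →
  skipsFrom false false (repeat a FF ++ repeat d FT ++ repeat e TT ++ repeat k (true ∷ [])) ≡ pred d
skips-FF-FT-TT-T a zero    e k = trans (skips-FF-unseen a _) (skips-trues false e k)
skips-FF-FT-TT-T a (suc d) e k = begin
  skipsFrom false false (repeat a FF ++ repeat (suc d) FT ++ trues) ≡⟨ skips-FF-unseen a _ ⟩
  skipsFrom true false (repeat d FT ++ trues)                     ≡⟨ skips-FT d trues ⟩
  d + skipsFrom true false trues                                  ≡⟨ cong (d +_) (skips-trues true e k) ⟩
  d + 0                                                           ≡⟨ +-identityʳ d ⟩
  d                                                               ∎
  where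
  open ≡-Reasoning
  trues = repeat e TT ++ repeat k (true ∷ [])

skips-FF-TF-TT-T : ∀ a d e k →
  skipsFrom false false (repeat a FF ++ repeat d TF ++ repeat e TT ++ repeat (suc k) (true ∷ [])) ≡ d
skips-FF-TF-TT-T a zero    e k = trans (skips-FF-unseen a _) (skips-trues false e (suc k))
skips-FF-TF-TT-T a (suc d) e k = begin
  skipsFrom false false (repeat a FF ++ repeat (suc d) TF ++ trues) ≡⟨ skips-FF-unseen a _ ⟩
  skipsFrom true true (repeat d TF ++ trues)                      ≡⟨ skips-TF d trues ⟩
  d + skipsFrom true true trues                                   ≡⟨ cong (d +_) (skips-closing e k) ⟩
  d + 1                                                           ≡⟨ +-comm d 1 ⟩
  suc d                                                           ∎
  where
  open ≡-Reasoning
  trues = repeat e TT ++ repeat (suc k) (true ∷ [])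

-- with no boxed entry after the last gap of the middle run, that gap is not a skip
GapClosed : ℕ → ℕ → Set
GapClosed d g = d ≡ 0 ⊎ 1 ≤ g

private
  skips-falses-trues : ∀ a f g →
    skipsFrom false false (repeat a FF ++ repeat (suc f) (false ∷ []) ++ repeat g (true ∷ [])) ≡ 0
  skips-falses-trues a f g = trans (skips-FF-unseen a _)
    (trans (skips-F false false f _) (trans (skipsFrom-unseen true (repeat g (true ∷ []))) (skips-trues false 0 g)))

skips-FF-TF-F-T : ∀ a d f g → GapClosed d g →
  skipsFrom false false (repeat a FF ++ repeat d TF ++ repeat (suc f) (false ∷ []) ++ repeat g (true ∷ [])) ≡ d
skips-FF-TF-F-T a zero    f g       _           = skips-falses-trues a f g
skips-FF-TF-F-T a (suc d) f (suc g) (inj₂ _)    = begin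
  skipsFrom false false (repeat a FF ++ repeat (suc d) TF ++ rest) ≡⟨ skips-FF-unseen a _ ⟩
  skipsFrom true true (repeat d TF ++ rest)                       ≡⟨ skips-TF d rest ⟩
  d + skipsFrom true true rest                                    ≡⟨ cong (d +_) (trans (skips-F true true f _) (skips-closing 0 g)) ⟩
  d + 1                                                           ≡⟨ +-comm d 1 ⟩
  suc d                                                           ∎
  where
  open ≡-Reasoning
  rest = repeat (suc f) (false ∷ []) ++ repeat (suc g) (true ∷ [])

skips-FF-FT-F-T : ∀ a d f g → GapClosed d g →
  skipsFrom false false (repeat a FF ++ repeat d FT ++ repeat (suc f) (false ∷ []) ++ repeat g (true ∷ [])) ≡ d
skips-FF-FT-F-T a zero    f g       _           = skips-falses-trues a f g
skips-FF-FT-F-T a (suc d) f (suc g) (inj₂ _)    = begin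
  skipsFrom false false (repeat a FF ++ repeat (suc d) FT ++ rest) ≡⟨ skips-FF-unseen a _ ⟩
  skipsFrom true false (repeat d FT ++ rest)                      ≡⟨ skips-FT d rest ⟩
  d + skipsFrom true false rest                                   ≡⟨ cong (d +_) (trans (skips-F true false f _) (skips-closing 0 g)) ⟩
  d + 1                                                           ≡⟨ +-comm d 1 ⟩
  suc d                                                           ∎
  where
  open ≡-Reasoning
  rest = repeat (suc f) (false ∷ []) ++ repeat (suc g) (true ∷ [])

-- The rank word

filterᵇ-accept : ∀ {A : Set} (P : A → Bool) {x} xs → P x ≡ true → filterᵇ P (x ∷ xs) ≡ x ∷ filterᵇ P xs
filterᵇ-accept P xs Px = filter-accept (λ x → T? (P x)) (subst T (sym Px) tt)

filterᵇ-reject : ∀ {A : Set} (P : A → Bool) {x} xs → P x ≡ false → filterᵇ P (x ∷ xs) ≡ filterᵇ P xs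
filterᵇ-reject P xs Px = filter-reject (λ x → T? (P x)) (λ t → subst T Px t)

filterᵇ-map : ∀ {A B : Set} (P : B → Bool) (f : A → B) xs → filterᵇ P (map f xs) ≡ map f (filterᵇ (λ x → P (f x)) xs)
filterᵇ-map P f []       = refl
filterᵇ-map P f (x ∷ xs) with P (f x)
... | true  = cong (f x ∷_) (filterᵇ-map P f xs)
... | false = filterᵇ-map P f xs

filterᵇ-interval-none : ∀ (P : ℕ → Bool) a k → (∀ i → i < k → P (a + i) ≡ false) → filterᵇ P (interval a k) ≡ []
filterᵇ-interval-none P a zero    none = refl
filterᵇ-interval-none P a (suc k) none =
  trans (filterᵇ-reject P _ (subst (λ x → P x ≡ false) (+-identityʳ a) (none 0 z<s)))
    (filterᵇ-interval-none P (suc a) k (λ i i<k → subst (λ x → P x ≡ false) (+-suc a i) (none (suc i) (s<s i<k))))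

filterᵇ-interval-point : ∀ (P : ℕ → Bool) a k e → e < k → P (a + e) ≡ true →
  (∀ i → i < k → i ≢ e → P (a + i) ≡ false) → filterᵇ P (interval a k) ≡ (a + e) ∷ []
filterᵇ-interval-point P a (suc k) zero    _       hit others =
  trans (filterᵇ-accept P _ (subst (λ x → P x ≡ true) (+-identityʳ a) hit))
    (cong₂ _∷_ (sym (+-identityʳ a))
      (filterᵇ-interval-none P (suc a) k (λ i i<k → subst (λ x → P x ≡ false) (+-suc a i) (others (suc i) (s<s i<k) (λ ())))))
filterᵇ-interval-point P a (suc k) (suc e) e<k hit others =
  trans (filterᵇ-reject P _ (subst (λ x → P x ≡ false) (+-identityʳ a) (others 0 z<s (λ ()))))
    (trans (filterᵇ-interval-point P (suc a) k e (≤-pred e<k) (subst (λ x → P x ≡ true) (+-suc a e) hit)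
             (λ i i<k i≢e → subst (λ x → P x ≡ false) (+-suc a i) (others (suc i) (s<s i<k) (i≢e ∘ suc-injective))))
      (cong (_∷ []) (sym (+-suc a e))))

hasRank : ℕ → ℕ → Cell → Bool
hasRank n ρ c = positiveRank n c ∧ (rankValue n c ≡ᵇ ρ)

<ᵇ∧∸≡ᵇ : ∀ x y ρ → 1 ≤ ρ → ((x <ᵇ y) ∧ ((y ∸ x) ≡ᵇ ρ)) ≡ (y ≡ᵇ ρ + x)
<ᵇ∧∸≡ᵇ x y ρ 1≤ρ with y ≟ ρ + x
... | yes refl = trans (∧-true (<ᵇ-true (+-monoˡ-≤ x 1≤ρ)) (≡ᵇ-true (m+n∸n≡m ρ x)))
                       (sym (≡ᵇ-true {ρ + x} refl))
... | no  y≢ρ+x with x <ᵇ y in x<y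
...   | false = sym (≡ᵇ-false y≢ρ+x)
...   | true  = trans (≡ᵇ-false (λ y∸x≡ρ → y≢ρ+x (trans (sym (m∸n+n≡m x≤y)) (cong (_+ x) y∸x≡ρ))))
                      (sym (≡ᵇ-false y≢ρ+x))
  where x≤y = <⇒≤ (<ᵇ⇒< x y (subst T (sym x<y) tt))

hasRank-≡ : ∀ n ρ a i → 1 ≤ ρ → hasRank n ρ (a , suc i) ≡ (3 * i ≡ᵇ ρ + n * a)
hasRank-≡ n ρ a i = <ᵇ∧∸≡ᵇ (n * a) (3 * i) ρ

rankColumn : ℕ → ℕ → ℕ → List ℕ
rankColumn n ρ a = filterᵇ (λ b → hasRank n ρ (a , b)) (interval 1 n)

rankColumn-hit : ∀ n ρ a e → 1 ≤ ρ → ρ + n * a ≡ 3 * e → e < n → rankColumn n ρ a ≡ suc e ∷ []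
rankColumn-hit n ρ a e 1≤ρ eq e<n = filterᵇ-interval-point _ 1 n e e<n
  (trans (hasRank-≡ n ρ a e 1≤ρ) (≡ᵇ-true (sym eq)))
  (λ i _ i≢e → trans (hasRank-≡ n ρ a i 1≤ρ) (≡ᵇ-false (λ 3i≡ → i≢e (*-cancelˡ-≡ i e 3 (trans 3i≡ eq)))))

rankColumn-beyond : ∀ n ρ a e → 1 ≤ ρ → ρ + n * a ≡ 3 * e → n ≤ e → rankColumn n ρ a ≡ []
rankColumn-beyond n ρ a e 1≤ρ eq n≤e = filterᵇ-interval-none _ 1 n λ i i<n →
  trans (hasRank-≡ n ρ a i 1≤ρ) (≡ᵇ-false (λ 3i≡ → <⇒≢ (<-≤-trans i<n n≤e) (*-cancelˡ-≡ i e 3 (trans 3i≡ eq))))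

rankColumn-off : ∀ n ρ a e k → 1 ≤ ρ → ρ + n * a ≡ 3 * e + suc k → k < 2 → rankColumn n ρ a ≡ []
rankColumn-off n ρ a e k 1≤ρ eq k<2 = filterᵇ-interval-none _ 1 n λ i _ →
  trans (hasRank-≡ n ρ a i 1≤ρ) (≡ᵇ-false (λ 3i≡ → 3*≢3*+ i (trans 3i≡ eq)))
  where
  3*≢3*+ : ∀ i → 3 * i ≢ 3 * e + suc k
  3*≢3*+ i eq′ with ≤-<-connex i e
  ... | inj₁ i≤e = <⇒≢ (≤-<-trans (*-monoʳ-≤ 3 i≤e) (m<m+n (3 * e) z<s)) eq′
  ... | inj₂ e<i = <⇒≢ (begin-strict
          3 * e + suc k  <⟨ +-monoʳ-< (3 * e) (s≤s k<2) ⟩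
          3 * e + 3      ≡⟨ solve (e ∷ []) ⟩
          3 * suc e      ≤⟨ *-monoʳ-≤ 3 e<i ⟩
          3 * i          ∎) (sym eq′)
    where open ≤-Reasoning

marksOfRank : ℕ → List Step → ℕ → List Bool
marksOfRank n p ρ = map (inLambda p) (filterᵇ (hasRank n ρ) (cells n))

marksOfRank-columns : ∀ n p ρ → marksOfRank n p ρ ≡
  map (inLambda p) (map (1 ,_) (rankColumn n ρ 1) ++ map (2 ,_) (rankColumn n ρ 2) ++ map (3 ,_) (rankColumn n ρ 3))
marksOfRank-columns n p ρ rewrite range1≡interval n = cong (map (inLambda p)) (begin
  filterᵇ R (map (1 ,_) I ++ map (2 ,_) I ++ map (3 ,_) I ++ [])
    ≡⟨ filter-++ (λ x → T? (R x)) (map (1 ,_) I) _ ⟩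
  filterᵇ R (map (1 ,_) I) ++ filterᵇ R (map (2 ,_) I ++ map (3 ,_) I ++ [])
    ≡⟨ cong (filterᵇ R (map (1 ,_) I) ++_) (filter-++ (λ x → T? (R x)) (map (2 ,_) I) _) ⟩
  filterᵇ R (map (1 ,_) I) ++ filterᵇ R (map (2 ,_) I) ++ filterᵇ R (map (3 ,_) I ++ [])
    ≡⟨ cong (λ X → filterᵇ R (map (1 ,_) I) ++ filterᵇ R (map (2 ,_) I) ++ filterᵇ R X) (++-identityʳ (map (3 ,_) I)) ⟩
  filterᵇ R (map (1 ,_) I) ++ filterᵇ R (map (2 ,_) I) ++ filterᵇ R (map (3 ,_) I)
    ≡⟨ cong₂ _++_ (filterᵇ-map R (1 ,_) I) (cong₂ _++_ (filterᵇ-map R (2 ,_) I) (filterᵇ-map R (3 ,_) I)) ⟩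
  map (1 ,_) (rankColumn n ρ 1) ++ map (2 ,_) (rankColumn n ρ 2) ++ map (3 ,_) (rankColumn n ρ 3) ∎)
  where
  open ≡-Reasoning
  I = interval 1 n
  R = hasRank n ρ

rankWord-marks : ∀ n p → map proj₂ (rankWord n p) ≡ concatMap (marksOfRank n p) (interval 1 (n * 3))
rankWord-marks n p = begin
  map proj₂ (rankWord n p)
    ≡⟨ map-concatMap proj₂ _ (range1 (3 * n)) ⟩
  concatMap (λ ρ → map proj₂ (map (λ c → (ρ , inLambda p c)) (filterᵇ (hasRank n ρ) (cells n)))) (range1 (3 * n))
    ≡⟨ concatMap-cong (λ ρ → sym (map-∘ (filterᵇ (hasRank n ρ) (cells n)))) (range1 (3 * n)) ⟩
  concatMap (marksOfRank n p) (range1 (3 * n))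
    ≡⟨ cong (concatMap (marksOfRank n p)) (trans (range1≡interval (3 * n)) (cong (interval 1) (*-comm 3 n))) ⟩
  concatMap (marksOfRank n p) (interval 1 (n * 3)) ∎
  where open ≡-Reasoning

rankTriple : (ℕ → List Bool) → ℕ → List Bool
rankTriple w t = w (1 + t * 3) ++ w (2 + t * 3) ++ w (3 + t * 3)

concatMap-rankTriples : ∀ (w : ℕ → List Bool) k t →
  concatMap w (interval (1 + t * 3) (k * 3)) ≡ concatMap (rankTriple w) (interval t k)
concatMap-rankTriples w zero    t = refl
concatMap-rankTriples w (suc k) t = begin
  w (1 + t * 3) ++ w (2 + t * 3) ++ w (3 + t * 3) ++ concatMap w (interval (1 + suc t * 3) (k * 3))
    ≡⟨ cong (λ X → w (1 + t * 3) ++ w (2 + t * 3) ++ w (3 + t * 3) ++ X) (concatMap-rankTriples w k (suc t)) ⟩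
  w (1 + t * 3) ++ w (2 + t * 3) ++ w (3 + t * 3) ++ rest
    ≡⟨ cong (w (1 + t * 3) ++_) (sym (++-assoc (w (2 + t * 3)) _ rest)) ⟩
  w (1 + t * 3) ++ (w (2 + t * 3) ++ w (3 + t * 3)) ++ rest
    ≡⟨ sym (++-assoc (w (1 + t * 3)) _ rest) ⟩
  rankTriple w t ++ rest ∎
  where
  open ≡-Reasoning
  rest = concatMap (rankTriple w) (interval (suc t) k)

marksOfRank-from : ∀ n p ρ {X Y Z} → rankColumn n ρ 1 ≡ X → rankColumn n ρ 2 ≡ Y → rankColumn n ρ 3 ≡ Z →
  marksOfRank n p ρ ≡ map (inLambda p) (map (1 ,_) X ++ map (2 ,_) Y ++ map (3 ,_) Z)
marksOfRank-from n p ρ refl refl refl = marksOfRank-columns n p ρ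

private
  1≤suc : ∀ {x} → 1 ≤ suc x
  1≤suc = s≤s z≤n

  0<2 : 0 < 2
  0<2 = s≤s z≤n

  1<2 : 1 < 2
  1<2 = s≤s (s≤s z≤n)

-- For n = 3m + 1 the ranks 3t + 1 lie in column 2 (cells exist for t < m) and
-- the ranks 3t + 2 in column 1 (for t < 2m); the ranks 3t + 3 belong to no cell.
module MarksOf3m+1 (m : ℕ) (p : List Step) where

  boxed₁ boxed₂ : ℕ → Bool
  boxed₁ t = inLambda p (1 , suc (t + m + 1))
  boxed₂ t = inLambda p (2 , suc (t + m + m + 1))

  n : ℕ
  n = 3 * m + 1

  private
    w : ℕ → List Bool
    w = marksOfRank n p

    w₁ : ∀ t {Y} → rankColumn n (1 + t * 3) 2 ≡ Y → w (1 + t * 3) ≡ map (inLambda p) (map (2 ,_) Y)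
    w₁ t col₂ = trans (marksOfRank-from n p (1 + t * 3)
        (rankColumn-off (3 * m + 1) (1 + t * 3) 1 (t + m) 1 1≤suc (solve (t ∷ m ∷ [])) 1<2) col₂
        (rankColumn-off (3 * m + 1) (1 + t * 3) 3 (t + m + m + m + 1) 0 1≤suc (solve (t ∷ m ∷ [])) 0<2))
      (cong (map (inLambda p)) (++-identityʳ _))

    w₂ : ∀ t {X} → rankColumn n (2 + t * 3) 1 ≡ X → w (2 + t * 3) ≡ map (inLambda p) (map (1 ,_) X)
    w₂ t col₁ = trans (marksOfRank-from n p (2 + t * 3) col₁
        (rankColumn-off (3 * m + 1) (2 + t * 3) 2 (t + m + m + 1) 0 1≤suc (solve (t ∷ m ∷ [])) 0<2)
        (rankColumn-off (3 * m + 1) (2 + t * 3) 3 (t + m + m + m + 1) 1 1≤suc (solve (t ∷ m ∷ [])) 1<2))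
      (cong (map (inLambda p)) (++-identityʳ _))

    w₃ : ∀ t → w (3 + t * 3) ≡ []
    w₃ t = marksOfRank-from n p (3 + t * 3)
        (rankColumn-off (3 * m + 1) (3 + t * 3) 1 (t + m + 1) 0 1≤suc (solve (t ∷ m ∷ [])) 0<2)
        (rankColumn-off (3 * m + 1) (3 + t * 3) 2 (t + m + m + 1) 1 1≤suc (solve (t ∷ m ∷ [])) 1<2)
        (rankColumn-beyond (3 * m + 1) (3 + t * 3) 3 (t + m + m + m + 2) 1≤suc (solve (t ∷ m ∷ []))
          (≤-witness (suc t) (solve (t ∷ m ∷ []))))

    column₂-hit : ∀ t → t < m → rankColumn n (1 + t * 3) 2 ≡ suc (t + m + m + 1) ∷ []
    column₂-hit t t<m = rankColumn-hit (3 * m + 1) (1 + t * 3) 2 (t + m + m + 1) 1≤suc (solve (t ∷ m ∷ []))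
      (begin-strict
        t + m + m + 1   <⟨ +-monoˡ-< 1 (+-monoˡ-< m (+-monoˡ-< m t<m)) ⟩
        m + m + m + 1   ≡⟨ solve (m ∷ []) ⟩
        3 * m + 1       ∎)
      where open ≤-Reasoning

    column₂-beyond : ∀ t → m ≤ t → rankColumn n (1 + t * 3) 2 ≡ []
    column₂-beyond t m≤t = rankColumn-beyond (3 * m + 1) (1 + t * 3) 2 (t + m + m + 1) 1≤suc (solve (t ∷ m ∷ []))
      (begin
        3 * m + 1       ≡⟨ solve (m ∷ []) ⟩
        m + m + m + 1   ≤⟨ +-monoˡ-≤ 1 (+-monoˡ-≤ m (+-monoˡ-≤ m m≤t)) ⟩
        t + m + m + 1   ∎)
      where open ≤-Reasoning

    column₁-hit : ∀ t → t < m + m → rankColumn n (2 + t * 3) 1 ≡ suc (t + m + 1) ∷ []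
    column₁-hit t t<2m = rankColumn-hit (3 * m + 1) (2 + t * 3) 1 (t + m + 1) 1≤suc (solve (t ∷ m ∷ []))
      (begin-strict
        t + m + 1       <⟨ +-monoˡ-< 1 (+-monoˡ-< m t<2m) ⟩
        m + m + m + 1   ≡⟨ solve (m ∷ []) ⟩
        3 * m + 1       ∎)
      where open ≤-Reasoning

    column₁-beyond : ∀ t → m + m ≤ t → rankColumn n (2 + t * 3) 1 ≡ []
    column₁-beyond t 2m≤t = rankColumn-beyond (3 * m + 1) (2 + t * 3) 1 (t + m + 1) 1≤suc (solve (t ∷ m ∷ []))
      (begin
        3 * m + 1       ≡⟨ solve (m ∷ []) ⟩
        m + m + m + 1   ≤⟨ +-monoˡ-≤ 1 (+-monoˡ-≤ m 2m≤t) ⟩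
        t + m + 1       ∎)
      where open ≤-Reasoning

  triple-pair : ∀ t → t < m → rankTriple (marksOfRank n p) t ≡ boxed₂ t ∷ boxed₁ t ∷ []
  triple-pair t t<m = cong₂ _++_ (w₁ t (column₂-hit t t<m))
    (cong₂ _++_ (w₂ t (column₁-hit t (≤-trans t<m (m≤m+n m m)))) (w₃ t))

  triple-single : ∀ t → m ≤ t → t < m + m → rankTriple (marksOfRank n p) t ≡ boxed₁ t ∷ []
  triple-single t m≤t t<2m = cong₂ _++_ (w₁ t (column₂-beyond t m≤t)) (cong₂ _++_ (w₂ t (column₁-hit t t<2m)) (w₃ t))

  triple-empty : ∀ t → m + m ≤ t → rankTriple (marksOfRank n p) t ≡ []
  triple-empty t 2m≤t = cong₂ _++_ (w₁ t (column₂-beyond t (≤-trans (m≤m+n m m) 2m≤t)))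
    (cong₂ _++_ (w₂ t (column₁-beyond t 2m≤t)) (w₃ t))

  marks : map proj₂ (rankWord n p) ≡
    concatMap (λ t → boxed₂ t ∷ boxed₁ t ∷ []) (interval 0 m) ++ concatMap (λ t → boxed₁ t ∷ []) (interval m m)
  marks = begin
    map proj₂ (rankWord n p)
      ≡⟨ rankWord-marks n p ⟩
    concatMap (marksOfRank n p) (interval 1 (n * 3))
      ≡⟨ concatMap-rankTriples (marksOfRank n p) n 0 ⟩
    concatMap triple (interval 0 n)
      ≡⟨ cong (λ k → concatMap triple (interval 0 k)) {x = 3 * m + 1} {y = m + m + (m + 1)} (solve (m ∷ [])) ⟩
    concatMap triple (interval 0 (m + m + (m + 1)))
      ≡⟨ concatMap-interval-+₃ triple 0 m m (m + 1) ⟩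
    concatMap triple (interval 0 m) ++ concatMap triple (interval m m) ++ concatMap triple (interval (m + m) (m + 1))
      ≡⟨ cong₂ _++_ (concatMap-interval-cong triple _ 0 m (λ i i<m → triple-pair i i<m))
          (cong₂ _++_ (concatMap-segment-cong triple _ 0 m m (λ i m≤i i<2m → triple-single i m≤i i<2m))
            (concatMap-segment-[] triple 0 (m + m) (m + 1) (λ i 2m≤i _ → triple-empty i 2m≤i))) ⟩
    concatMap (λ t → boxed₂ t ∷ boxed₁ t ∷ []) (interval 0 m) ++ concatMap (λ t → boxed₁ t ∷ []) (interval m m) ++ []
      ≡⟨ cong (concatMap (λ t → boxed₂ t ∷ boxed₁ t ∷ []) (interval 0 m) ++_) (++-identityʳ _) ⟩
    concatMap (λ t → boxed₂ t ∷ boxed₁ t ∷ []) (interval 0 m) ++ concatMap (λ t → boxed₁ t ∷ []) (interval m m) ∎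
    where
    open ≡-Reasoning
    triple : ℕ → List Bool
    triple = rankTriple (marksOfRank n p)

-- For n = 3m + 2 the ranks 3t + 1 lie in column 1 (cells exist for t < 2m + 1) and
-- the ranks 3t + 2 in column 2 (for t < m); the ranks 3t + 3 belong to no cell.
module MarksOf3m+2 (m : ℕ) (p : List Step) where

  boxed₁ boxed₂ : ℕ → Bool
  boxed₁ t = inLambda p (1 , suc (t + m + 1))
  boxed₂ t = inLambda p (2 , suc (t + m + m + 2))

  n : ℕ
  n = 3 * m + 2

  private
    w : ℕ → List Bool
    w = marksOfRank n p

    w₁ : ∀ t {X} → rankColumn n (1 + t * 3) 1 ≡ X → w (1 + t * 3) ≡ map (inLambda p) (map (1 ,_) X)
    w₁ t col₁ = trans (marksOfRank-from n p (1 + t * 3) col₁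
        (rankColumn-off (3 * m + 2) (1 + t * 3) 2 (t + m + m + 1) 1 1≤suc (solve (t ∷ m ∷ [])) 1<2)
        (rankColumn-off (3 * m + 2) (1 + t * 3) 3 (t + m + m + m + 2) 0 1≤suc (solve (t ∷ m ∷ [])) 0<2))
      (cong (map (inLambda p)) (++-identityʳ _))

    w₂ : ∀ t {Y} → rankColumn n (2 + t * 3) 2 ≡ Y → w (2 + t * 3) ≡ map (inLambda p) (map (2 ,_) Y)
    w₂ t col₂ = trans (marksOfRank-from n p (2 + t * 3)
        (rankColumn-off (3 * m + 2) (2 + t * 3) 1 (t + m + 1) 0 1≤suc (solve (t ∷ m ∷ [])) 0<2) col₂
        (rankColumn-off (3 * m + 2) (2 + t * 3) 3 (t + m + m + m + 2) 1 1≤suc (solve (t ∷ m ∷ [])) 1<2))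
      (cong (map (inLambda p)) (++-identityʳ _))

    w₃ : ∀ t → w (3 + t * 3) ≡ []
    w₃ t = marksOfRank-from n p (3 + t * 3)
        (rankColumn-off (3 * m + 2) (3 + t * 3) 1 (t + m + 1) 1 1≤suc (solve (t ∷ m ∷ [])) 1<2)
        (rankColumn-off (3 * m + 2) (3 + t * 3) 2 (t + m + m + 2) 0 1≤suc (solve (t ∷ m ∷ [])) 0<2)
        (rankColumn-beyond (3 * m + 2) (3 + t * 3) 3 (t + m + m + m + 3) 1≤suc (solve (t ∷ m ∷ []))
          (≤-witness (suc t) (solve (t ∷ m ∷ []))))

    column₁-hit : ∀ t → t < m + m + 1 → rankColumn n (1 + t * 3) 1 ≡ suc (t + m + 1) ∷ []
    column₁-hit t t<2m+1 = rankColumn-hit (3 * m + 2) (1 + t * 3) 1 (t + m + 1) 1≤suc (solve (t ∷ m ∷ []))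
      (begin-strict
        t + m + 1           <⟨ +-monoˡ-< 1 (+-monoˡ-< m t<2m+1) ⟩
        m + m + 1 + m + 1   ≡⟨ solve (m ∷ []) ⟩
        3 * m + 2           ∎)
      where open ≤-Reasoning

    column₁-beyond : ∀ t → m + m + 1 ≤ t → rankColumn n (1 + t * 3) 1 ≡ []
    column₁-beyond t 2m+1≤t = rankColumn-beyond (3 * m + 2) (1 + t * 3) 1 (t + m + 1) 1≤suc (solve (t ∷ m ∷ []))
      (begin
        3 * m + 2           ≡⟨ solve (m ∷ []) ⟩
        m + m + 1 + m + 1   ≤⟨ +-monoˡ-≤ 1 (+-monoˡ-≤ m 2m+1≤t) ⟩
        t + m + 1           ∎)
      where open ≤-Reasoning

    column₂-hit : ∀ t → t < m → rankColumn n (2 + t * 3) 2 ≡ suc (t + m + m + 2) ∷ []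
    column₂-hit t t<m = rankColumn-hit (3 * m + 2) (2 + t * 3) 2 (t + m + m + 2) 1≤suc (solve (t ∷ m ∷ []))
      (begin-strict
        t + m + m + 2   <⟨ +-monoˡ-< 2 (+-monoˡ-< m (+-monoˡ-< m t<m)) ⟩
        m + m + m + 2   ≡⟨ solve (m ∷ []) ⟩
        3 * m + 2       ∎)
      where open ≤-Reasoning

    column₂-beyond : ∀ t → m ≤ t → rankColumn n (2 + t * 3) 2 ≡ []
    column₂-beyond t m≤t = rankColumn-beyond (3 * m + 2) (2 + t * 3) 2 (t + m + m + 2) 1≤suc (solve (t ∷ m ∷ []))
      (begin
        3 * m + 2       ≡⟨ solve (m ∷ []) ⟩
        m + m + m + 2   ≤⟨ +-monoˡ-≤ 2 (+-monoˡ-≤ m (+-monoˡ-≤ m m≤t)) ⟩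
        t + m + m + 2   ∎)
      where open ≤-Reasoning

  triple-pair : ∀ t → t < m → rankTriple (marksOfRank n p) t ≡ boxed₁ t ∷ boxed₂ t ∷ []
  triple-pair t t<m = cong₂ _++_ (w₁ t (column₁-hit t (≤-trans t<m (≤-trans (m≤m+n m m) (m≤m+n (m + m) 1)))))
    (cong₂ _++_ (w₂ t (column₂-hit t t<m)) (w₃ t))

  triple-single : ∀ t → m ≤ t → t < m + m + 1 → rankTriple (marksOfRank n p) t ≡ boxed₁ t ∷ []
  triple-single t m≤t t<2m+1 = cong₂ _++_ (w₁ t (column₁-hit t t<2m+1)) (cong₂ _++_ (w₂ t (column₂-beyond t m≤t)) (w₃ t))

  triple-empty : ∀ t → m + m + 1 ≤ t → rankTriple (marksOfRank n p) t ≡ []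
  triple-empty t 2m+1≤t = cong₂ _++_ (w₁ t (column₁-beyond t 2m+1≤t))
    (cong₂ _++_ (w₂ t (column₂-beyond t (≤-trans (≤-trans (m≤m+n m m) (m≤m+n (m + m) 1)) 2m+1≤t))) (w₃ t))

  marks : map proj₂ (rankWord n p) ≡
    concatMap (λ t → boxed₁ t ∷ boxed₂ t ∷ []) (interval 0 m) ++ concatMap (λ t → boxed₁ t ∷ []) (interval m (m + 1))
  marks = begin
    map proj₂ (rankWord n p)
      ≡⟨ rankWord-marks n p ⟩
    concatMap (marksOfRank n p) (interval 1 (n * 3))
      ≡⟨ concatMap-rankTriples (marksOfRank n p) n 0 ⟩
    concatMap triple (interval 0 n)
      ≡⟨ cong (λ k → concatMap triple (interval 0 k)) {x = 3 * m + 2} {y = m + (m + 1) + (m + 1)} (solve (m ∷ [])) ⟩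
    concatMap triple (interval 0 (m + (m + 1) + (m + 1)))
      ≡⟨ concatMap-interval-+₃ triple 0 m (m + 1) (m + 1) ⟩
    concatMap triple (interval 0 m) ++ concatMap triple (interval m (m + 1)) ++ concatMap triple (interval (m + (m + 1)) (m + 1))
      ≡⟨ cong₂ _++_ (concatMap-interval-cong triple _ 0 m (λ i i<m → triple-pair i i<m))
          (cong₂ _++_ (concatMap-segment-cong triple _ 0 m (m + 1) (λ i m≤i i< → triple-single i m≤i (subst (i <_) (sym (+-assoc m m 1)) i<)))
            (concatMap-segment-[] triple 0 (m + (m + 1)) (m + 1) (λ i ≤i _ → triple-empty i (subst (_≤ i) (sym (+-assoc m m 1)) ≤i)))) ⟩
    concatMap (λ t → boxed₁ t ∷ boxed₂ t ∷ []) (interval 0 m) ++ concatMap (λ t → boxed₁ t ∷ []) (interval m (m + 1)) ++ []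
      ≡⟨ cong (concatMap (λ t → boxed₁ t ∷ boxed₂ t ∷ []) (interval 0 m) ++_) (++-identityʳ _) ⟩
    concatMap (λ t → boxed₁ t ∷ boxed₂ t ∷ []) (interval 0 m) ++ concatMap (λ t → boxed₁ t ∷ []) (interval m (m + 1)) ∎
    where
    open ≡-Reasoning
    triple : ℕ → List Bool
    triple = rankTriple (marksOfRank n p)

-- skip

+-<ᵇ-cancelˡ : ∀ k x y → (k + x <ᵇ k + y) ≡ (x <ᵇ y)
+-<ᵇ-cancelˡ zero    x y = refl
+-<ᵇ-cancelˡ (suc k) x y = +-<ᵇ-cancelˡ k x y

reached-false : ∀ {p t} → t < p → (p <ᵇ suc t) ≡ false
reached-false t<p = <ᵇ-false t<p

reached-true : ∀ {p t} → p ≤ t → (p <ᵇ suc t) ≡ true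
reached-true p≤t = <ᵇ-true (s≤s p≤t)

pair≡ : ∀ {x y x′ y′ : Bool} → x ≡ x′ → y ≡ y′ → x ∷ y ∷ [] ≡ x′ ∷ y′ ∷ []
pair≡ = cong₂ (λ a b → a ∷ b ∷ [])

single≡ : ∀ {x x′ : Bool} → x ≡ x′ → x ∷ [] ≡ x′ ∷ []
single≡ = cong (_∷ [])

private
  reassoc : ∀ {A : Set} (a b c d : List A) → (a ++ b ++ c) ++ d ≡ a ++ b ++ c ++ d
  reassoc a b c d = trans (++-assoc a (b ++ c) d) (cong (a ++_) (++-assoc b c d))

module SkipOf3m+1 (m : ℕ) (p : List Step) (p₁ p₂ : ℕ)
  (height₁ : height p 1 ≡ suc (m + p₁)) (height₂ : height p 2 ≡ suc (m + m + 0 + p₂)) where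
  open MarksOf3m+1 m p

  u v : ℕ → Bool
  u t = p₁ <ᵇ suc t
  v t = p₂ <ᵇ suc t

  boxed₁≡u : ∀ t → boxed₁ t ≡ u t
  boxed₁≡u t = trans (cong (_<ᵇ suc (t + m + 1)) height₁)
    (trans (cong (m + p₁ <ᵇ_) shift) (+-<ᵇ-cancelˡ m p₁ (suc t)))
    where
    shift : t + m + 1 ≡ m + suc t
    shift = solve (t ∷ m ∷ [])

  boxed₂≡v : ∀ t → boxed₂ t ≡ v t
  boxed₂≡v t = trans (cong (_<ᵇ suc (t + m + m + 1)) height₂)
    (trans (cong (m + m + 0 + p₂ <ᵇ_) shift) (+-<ᵇ-cancelˡ (m + m + 0) p₂ (suc t)))
    where
    shift : t + m + m + 1 ≡ m + m + 0 + suc t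
    shift = solve (t ∷ m ∷ [])

  skip≡ : skip n p ≡ skipsFrom false false
    (concatMap (λ t → v t ∷ u t ∷ []) (interval 0 m) ++ concatMap (λ t → u t ∷ []) (interval m m))
  skip≡ = trans (countSkips≡skipsFrom false (map proj₂ (rankWord n p))) (cong (skipsFrom false false) (trans marks
    (cong₂ _++_ (concatMap-cong (λ t → pair≡ (boxed₂≡v t) (boxed₁≡u t)) (interval 0 m))
                (concatMap-cong (λ t → single≡ (boxed₁≡u t)) (interval m m)))))

  private
    pairs singles : ℕ → List Bool
    pairs t   = v t ∷ u t ∷ []
    singles t = u t ∷ []

  skip-p₁≤p₂ : ∀ d e → p₁ + d ≡ p₂ → p₂ + e ≡ m → skip n p ≡ pred d
  skip-p₁≤p₂ d e refl refl = begin
    skip n p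
      ≡⟨ skip≡ ⟩
    skipsFrom false false (concatMap pairs (interval 0 (p₁ + d + e)) ++ concatMap singles (interval (p₁ + d + e) (p₁ + d + e)))
      ≡⟨ cong (skipsFrom false false) (cong₂ _++_ pairs≡ singles≡) ⟩
    skipsFrom false false ((repeat p₁ FF ++ repeat d FT ++ repeat e TT) ++ repeat (p₁ + d + e) (true ∷ []))
      ≡⟨ cong (skipsFrom false false) (reassoc (repeat p₁ FF) (repeat d FT) (repeat e TT) _) ⟩
    skipsFrom false false (repeat p₁ FF ++ repeat d FT ++ repeat e TT ++ repeat (p₁ + d + e) (true ∷ []))
      ≡⟨ skips-FF-FT-TT-T p₁ d e (p₁ + d + e) ⟩
    pred d ∎
    where
    open ≡-Reasoning
    pairs≡ : concatMap pairs (interval 0 (p₁ + d + e)) ≡ repeat p₁ FF ++ repeat d FT ++ repeat e TT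
    pairs≡ = trans (concatMap-interval-+₃ pairs 0 p₁ d e) (cong₂ _++_
      (concatMap-interval-const pairs 0 p₁ FF (λ i i<p₁ →
        pair≡ (reached-false (<-≤-trans i<p₁ (m≤m+n p₁ d))) (reached-false i<p₁)))
      (cong₂ _++_
        (concatMap-segment-const pairs 0 p₁ d FT (λ i p₁≤i i<p₂ → pair≡ (reached-false i<p₂) (reached-true p₁≤i)))
        (concatMap-segment-const pairs 0 (p₁ + d) e TT (λ i p₂≤i _ →
          pair≡ (reached-true p₂≤i) (reached-true (≤-trans (m≤m+n p₁ d) p₂≤i))))))
    singles≡ : concatMap singles (interval (p₁ + d + e) (p₁ + d + e)) ≡ repeat (p₁ + d + e) (true ∷ [])
    singles≡ = concatMap-interval-const singles (p₁ + d + e) (p₁ + d + e) (true ∷ []) (λ i _ →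
      single≡ (reached-true (≤-trans (≤-trans (m≤m+n p₁ d) (m≤m+n _ e)) (m≤m+n _ i))))

  skip-p₂<p₁≤m : ∀ d e → p₂ + suc d ≡ p₁ → p₁ + e ≡ m → skip n p ≡ suc d
  skip-p₂<p₁≤m d e refl refl = begin
    skip n p
      ≡⟨ skip≡ ⟩
    skipsFrom false false (concatMap pairs (interval 0 M) ++ concatMap singles (interval M M))
      ≡⟨ cong (skipsFrom false false) (cong₂ _++_ pairs≡ singles≡) ⟩
    skipsFrom false false ((repeat p₂ FF ++ repeat (suc d) TF ++ repeat e TT) ++ repeat (suc (p₂ + d + e)) (true ∷ []))
      ≡⟨ cong (skipsFrom false false) (reassoc (repeat p₂ FF) (repeat (suc d) TF) (repeat e TT) _) ⟩
    skipsFrom false false (repeat p₂ FF ++ repeat (suc d) TF ++ repeat e TT ++ repeat (suc (p₂ + d + e)) (true ∷ []))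
      ≡⟨ skips-FF-TF-TT-T p₂ (suc d) e (p₂ + d + e) ⟩
    suc d ∎
    where
    open ≡-Reasoning
    M : ℕ
    M = p₂ + suc d + e
    pairs≡ : concatMap pairs (interval 0 M) ≡ repeat p₂ FF ++ repeat (suc d) TF ++ repeat e TT
    pairs≡ = trans (concatMap-interval-+₃ pairs 0 p₂ (suc d) e) (cong₂ _++_
      (concatMap-interval-const pairs 0 p₂ FF (λ i i<p₂ →
        pair≡ (reached-false i<p₂) (reached-false (<-≤-trans i<p₂ (m≤m+n p₂ (suc d))))))
      (cong₂ _++_
        (concatMap-segment-const pairs 0 p₂ (suc d) TF (λ i p₂≤i i<p₁ → pair≡ (reached-true p₂≤i) (reached-false i<p₁)))
        (concatMap-segment-const pairs 0 (p₂ + suc d) e TT (λ i p₁≤i _ →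
          pair≡ (reached-true (≤-trans (m≤m+n p₂ (suc d)) p₁≤i)) (reached-true p₁≤i)))))
    singles≡ : concatMap singles (interval M M) ≡ repeat (suc (p₂ + d + e)) (true ∷ [])
    singles≡ = trans (concatMap-interval-const singles M M (true ∷ []) (λ i _ →
      single≡ (reached-true (≤-trans (m≤m+n (p₂ + suc d) e) (m≤m+n M i)))))
      (cong (λ k → repeat k (true ∷ [])) (cong (_+ e) (+-suc p₂ d)))

  skip-m<p₁ : ∀ d f g → p₂ + d ≡ m → m + suc f ≡ p₁ → p₁ + g ≡ m + m → GapClosed d g → skip n p ≡ d
  skip-m<p₁ d f g refl refl p₁+g≡2m closed = begin
    skip n p
      ≡⟨ skip≡ ⟩
    skipsFrom false false (concatMap pairs (interval 0 M) ++ concatMap singles (interval M M))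
      ≡⟨ cong (skipsFrom false false) (cong₂ _++_ pairs≡ singles≡) ⟩
    skipsFrom false false ((repeat p₂ FF ++ repeat d TF) ++ repeat (suc f) (false ∷ []) ++ repeat g (true ∷ []))
      ≡⟨ cong (skipsFrom false false) (++-assoc (repeat p₂ FF) (repeat d TF) _) ⟩
    skipsFrom false false (repeat p₂ FF ++ repeat d TF ++ repeat (suc f) (false ∷ []) ++ repeat g (true ∷ []))
      ≡⟨ skips-FF-TF-F-T p₂ d f g closed ⟩
    d ∎
    where
    open ≡-Reasoning
    M : ℕ
    M = p₂ + d
    M≡1+f+g : M ≡ suc f + g
    M≡1+f+g = sym (+-cancelˡ-≡ M _ _ (trans (sym (+-assoc M (suc f) g)) p₁+g≡2m))
    pairs≡ : concatMap pairs (interval 0 M) ≡ repeat p₂ FF ++ repeat d TF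
    pairs≡ = trans (concatMap-interval-+ pairs 0 p₂ d) (cong₂ _++_
      (concatMap-interval-const pairs 0 p₂ FF (λ i i<p₂ →
        pair≡ (reached-false i<p₂) (reached-false (<-≤-trans i<p₂ (≤-trans (m≤m+n p₂ d) (m≤m+n M (suc f)))))))
      (concatMap-segment-const pairs 0 p₂ d TF (λ i p₂≤i i<M →
        pair≡ (reached-true p₂≤i) (reached-false (<-≤-trans i<M (m≤m+n M (suc f)))))))
    singles≡ : concatMap singles (interval M M) ≡ repeat (suc f) (false ∷ []) ++ repeat g (true ∷ [])
    singles≡ = trans (cong (λ k → concatMap singles (interval M k)) M≡1+f+g)
      (trans (concatMap-interval-+ singles M (suc f) g) (cong₂ _++_
        (concatMap-interval-const singles M (suc f) (false ∷ []) (λ i i<1+f → single≡ (reached-false (+-monoʳ-< M i<1+f))))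
        (concatMap-interval-const singles (M + suc f) g (true ∷ []) (λ i _ → single≡ (reached-true (m≤m+n (M + suc f) i))))))

module SkipOf3m+2 (m : ℕ) (p : List Step) (p₁ p₂ : ℕ)
  (height₁ : height p 1 ≡ suc (m + p₁)) (height₂ : height p 2 ≡ suc (m + m + 1 + p₂)) where
  open MarksOf3m+2 m p

  u v : ℕ → Bool
  u t = p₁ <ᵇ suc t
  v t = p₂ <ᵇ suc t

  boxed₁≡u : ∀ t → boxed₁ t ≡ u t
  boxed₁≡u t = trans (cong (_<ᵇ suc (t + m + 1)) height₁)
    (trans (cong (m + p₁ <ᵇ_) shift) (+-<ᵇ-cancelˡ m p₁ (suc t)))
    where
    shift : t + m + 1 ≡ m + suc t
    shift = solve (t ∷ m ∷ [])

  boxed₂≡v : ∀ t → boxed₂ t ≡ v t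
  boxed₂≡v t = trans (cong (_<ᵇ suc (t + m + m + 2)) height₂)
    (trans (cong (m + m + 1 + p₂ <ᵇ_) shift) (+-<ᵇ-cancelˡ (m + m + 1) p₂ (suc t)))
    where
    shift : t + m + m + 2 ≡ m + m + 1 + suc t
    shift = solve (t ∷ m ∷ [])

  private
    pairs singles : ℕ → List Bool
    pairs t   = u t ∷ v t ∷ []
    singles t = u t ∷ []

  skip≡ : skip n p ≡ skipsFrom false false (concatMap pairs (interval 0 m) ++ concatMap singles (interval m (m + 1)))
  skip≡ = trans (countSkips≡skipsFrom false (map proj₂ (rankWord n p))) (cong (skipsFrom false false) (trans marks
    (cong₂ _++_ (concatMap-cong (λ t → pair≡ (boxed₁≡u t) (boxed₂≡v t)) (interval 0 m))
                (concatMap-cong (λ t → single≡ (boxed₁≡u t)) (interval m (m + 1))))))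

  private
    singles-all : p₁ ≤ m → concatMap singles (interval m (m + 1)) ≡ repeat (suc m) (true ∷ [])
    singles-all p₁≤m = trans (concatMap-interval-const singles m (m + 1) (true ∷ []) (λ i _ →
      single≡ (reached-true (≤-trans p₁≤m (m≤m+n m i))))) (cong (λ k → repeat k (true ∷ [])) (+-comm m 1))

  skip-p₁≤p₂ : ∀ d e → p₁ + d ≡ p₂ → p₂ + e ≡ m → skip n p ≡ d
  skip-p₁≤p₂ d e refl refl = begin
    skip n p
      ≡⟨ skip≡ ⟩
    skipsFrom false false (concatMap pairs (interval 0 M) ++ concatMap singles (interval M (M + 1)))
      ≡⟨ cong (skipsFrom false false) (cong₂ _++_ pairs≡ (singles-all (≤-trans (m≤m+n p₁ d) (m≤m+n _ e)))) ⟩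
    skipsFrom false false ((repeat p₁ FF ++ repeat d TF ++ repeat e TT) ++ repeat (suc M) (true ∷ []))
      ≡⟨ cong (skipsFrom false false) (reassoc (repeat p₁ FF) (repeat d TF) (repeat e TT) _) ⟩
    skipsFrom false false (repeat p₁ FF ++ repeat d TF ++ repeat e TT ++ repeat (suc M) (true ∷ []))
      ≡⟨ skips-FF-TF-TT-T p₁ d e M ⟩
    d ∎
    where
    open ≡-Reasoning
    M : ℕ
    M = p₁ + d + e
    pairs≡ : concatMap pairs (interval 0 M) ≡ repeat p₁ FF ++ repeat d TF ++ repeat e TT
    pairs≡ = trans (concatMap-interval-+₃ pairs 0 p₁ d e) (cong₂ _++_
      (concatMap-interval-const pairs 0 p₁ FF (λ i i<p₁ →
        pair≡ (reached-false i<p₁) (reached-false (<-≤-trans i<p₁ (m≤m+n p₁ d)))))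
      (cong₂ _++_
        (concatMap-segment-const pairs 0 p₁ d TF (λ i p₁≤i i<p₂ → pair≡ (reached-true p₁≤i) (reached-false i<p₂)))
        (concatMap-segment-const pairs 0 (p₁ + d) e TT (λ i p₂≤i _ →
          pair≡ (reached-true (≤-trans (m≤m+n p₁ d) p₂≤i)) (reached-true p₂≤i)))))

  skip-p₂≤p₁≤m : ∀ d e → p₂ + d ≡ p₁ → p₁ + e ≡ m → skip n p ≡ pred d
  skip-p₂≤p₁≤m d e refl refl = begin
    skip n p
      ≡⟨ skip≡ ⟩
    skipsFrom false false (concatMap pairs (interval 0 M) ++ concatMap singles (interval M (M + 1)))
      ≡⟨ cong (skipsFrom false false) (cong₂ _++_ pairs≡ (singles-all (m≤m+n _ e))) ⟩
    skipsFrom false false ((repeat p₂ FF ++ repeat d FT ++ repeat e TT) ++ repeat (suc M) (true ∷ []))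
      ≡⟨ cong (skipsFrom false false) (reassoc (repeat p₂ FF) (repeat d FT) (repeat e TT) _) ⟩
    skipsFrom false false (repeat p₂ FF ++ repeat d FT ++ repeat e TT ++ repeat (suc M) (true ∷ []))
      ≡⟨ skips-FF-FT-TT-T p₂ d e (suc M) ⟩
    pred d ∎
    where
    open ≡-Reasoning
    M : ℕ
    M = p₂ + d + e
    pairs≡ : concatMap pairs (interval 0 M) ≡ repeat p₂ FF ++ repeat d FT ++ repeat e TT
    pairs≡ = trans (concatMap-interval-+₃ pairs 0 p₂ d e) (cong₂ _++_
      (concatMap-interval-const pairs 0 p₂ FF (λ i i<p₂ →
        pair≡ (reached-false (<-≤-trans i<p₂ (m≤m+n p₂ d))) (reached-false i<p₂)))
      (cong₂ _++_
        (concatMap-segment-const pairs 0 p₂ d FT (λ i p₂≤i i<p₁ → pair≡ (reached-false i<p₁) (reached-true p₂≤i)))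
        (concatMap-segment-const pairs 0 (p₂ + d) e TT (λ i p₁≤i _ →
          pair≡ (reached-true p₁≤i) (reached-true (≤-trans (m≤m+n p₂ d) p₁≤i))))))

  skip-m<p₁ : ∀ d f g → p₂ + d ≡ m → m + suc f ≡ p₁ → p₁ + g ≡ m + m + 1 → GapClosed d g → skip n p ≡ d
  skip-m<p₁ d f g refl refl p₁+g≡2m+1 closed = begin
    skip n p
      ≡⟨ skip≡ ⟩
    skipsFrom false false (concatMap pairs (interval 0 M) ++ concatMap singles (interval M (M + 1)))
      ≡⟨ cong (skipsFrom false false) (cong₂ _++_ pairs≡ singles≡) ⟩
    skipsFrom false false ((repeat p₂ FF ++ repeat d FT) ++ repeat (suc f) (false ∷ []) ++ repeat g (true ∷ []))
      ≡⟨ cong (skipsFrom false false) (++-assoc (repeat p₂ FF) (repeat d FT) _) ⟩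
    skipsFrom false false (repeat p₂ FF ++ repeat d FT ++ repeat (suc f) (false ∷ []) ++ repeat g (true ∷ []))
      ≡⟨ skips-FF-FT-F-T p₂ d f g closed ⟩
    d ∎
    where
    open ≡-Reasoning
    M : ℕ
    M = p₂ + d
    M+1≡1+f+g : M + 1 ≡ suc f + g
    M+1≡1+f+g = sym (+-cancelˡ-≡ M _ _ (trans (sym (+-assoc M (suc f) g)) (trans p₁+g≡2m+1 (+-assoc M M 1))))
    pairs≡ : concatMap pairs (interval 0 M) ≡ repeat p₂ FF ++ repeat d FT
    pairs≡ = trans (concatMap-interval-+ pairs 0 p₂ d) (cong₂ _++_
      (concatMap-interval-const pairs 0 p₂ FF (λ i i<p₂ →
        pair≡ (reached-false (<-≤-trans i<p₂ (≤-trans (m≤m+n p₂ d) (m≤m+n M (suc f))))) (reached-false i<p₂)))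
      (concatMap-segment-const pairs 0 p₂ d FT (λ i p₂≤i i<M →
        pair≡ (reached-false (<-≤-trans i<M (m≤m+n M (suc f)))) (reached-true p₂≤i))))
    singles≡ : concatMap singles (interval M (M + 1)) ≡ repeat (suc f) (false ∷ []) ++ repeat g (true ∷ [])
    singles≡ = trans (cong (λ k → concatMap singles (interval M k)) M+1≡1+f+g)
      (trans (concatMap-interval-+ singles M (suc f) g) (cong₂ _++_
        (concatMap-interval-const singles M (suc f) (false ∷ []) (λ i i<1+f → single≡ (reached-false (+-monoʳ-< M i<1+f))))
        (concatMap-interval-const singles (M + suc f) g (true ∷ []) (λ i _ → single≡ (reached-true (m≤m+n (M + suc f) i))))))

-- The three regions

-- skip and dinv of the path with excesses p₁ , p₂ over the line, n = 3m + 1 + r: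
--   I   (p₁ < r + p₂)          skip = r + p₂ - p₁ - 1   dinv = 3m + 1 - 2p₂
--   II  (r + p₂ ≤ p₁ < r + m)  skip = p₁ - r - p₂       dinv = 3m + 2r - 2p₁
--   III (r + m ≤ p₁)           skip = m - p₂            dinv = 2m + r - p₁
data Region (m r p₁ p₂ s d : ℕ) : Set where
  regionI   : suc p₁ ≤ r + p₂ → suc (s + p₁) ≡ r + p₂ → d + (p₂ + p₂) ≡ 3 * m + 1 → Region m r p₁ p₂ s d
  regionII  : r + p₂ ≤ p₁ → suc p₁ ≤ r + m → s + (r + p₂) ≡ p₁ → d + (p₁ + p₁) ≡ 3 * m + (r + r) → Region m r p₁ p₂ s d
  regionIII : r + m ≤ p₁ → s + p₂ ≡ m → d + p₁ ≡ m + m + r → Region m r p₁ p₂ s d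

region-functional : ∀ {m r p₁ p₂ s d s′ d′} → p₂ ≤ m → Region m r p₁ p₂ s d → Region m r p₁ p₂ s′ d′ → s ≡ s′ × d ≡ d′
region-functional _ (regionI _ s≡ d≡) (regionI _ s′≡ d′≡) =
  +-cancelʳ-≡ _ _ _ (suc-injective (trans s≡ (sym s′≡))) , +-cancelʳ-≡ _ _ _ (trans d≡ (sym d′≡))
region-functional _ (regionII _ _ s≡ d≡) (regionII _ _ s′≡ d′≡) =
  +-cancelʳ-≡ _ _ _ (trans s≡ (sym s′≡)) , +-cancelʳ-≡ _ _ _ (trans d≡ (sym d′≡))
region-functional _ (regionIII _ s≡ d≡) (regionIII _ s′≡ d′≡) =
  +-cancelʳ-≡ _ _ _ (trans s≡ (sym s′≡)) , +-cancelʳ-≡ _ _ _ (trans d≡ (sym d′≡))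
region-functional _ (regionI I _ _) (regionII II _ _ _) = ⊥-elim (<-irrefl refl (≤-trans I II))
region-functional _ (regionII II _ _ _) (regionI I _ _) = ⊥-elim (<-irrefl refl (≤-trans I II))
region-functional _ (regionII _ II _ _) (regionIII III _ _) = ⊥-elim (<-irrefl refl (≤-trans II III))
region-functional _ (regionIII III _ _) (regionII _ II _ _) = ⊥-elim (<-irrefl refl (≤-trans II III))
region-functional p₂≤m (regionI I _ _) (regionIII III _ _) = ⊥-elim (<-irrefl refl (≤-trans I (≤-trans (+-monoʳ-≤ _ p₂≤m) III)))
region-functional p₂≤m (regionIII III _ _) (regionI I _ _) = ⊥-elim (<-irrefl refl (≤-trans I (≤-trans (+-monoʳ-≤ _ p₂≤m) III)))

double-injective : ∀ a b → a + a ≡ b + b → a ≡ b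
double-injective a b eq = *-cancelˡ-≡ a b 2 (begin
  2 * a   ≡⟨ solve (a ∷ []) ⟩
  a + a   ≡⟨ eq ⟩
  b + b   ≡⟨ solve (b ∷ []) ⟩
  2 * b   ∎)
  where open ≡-Reasoning

regionI⇒m<d : ∀ m d p₂ → d + (p₂ + p₂) ≡ 3 * m + 1 → p₂ ≤ m → m < d
regionI⇒m<d m d p₂ d≡ p₂≤m = +-cancelʳ-≤ (m + m) (suc m) d (begin
  suc m + (m + m)  ≡⟨ solve (m ∷ []) ⟩
  3 * m + 1        ≡⟨ d≡ ⟨
  d + (p₂ + p₂)    ≤⟨ +-monoʳ-≤ d (+-mono-≤ p₂≤m p₂≤m) ⟩
  d + (m + m)      ∎)
  where open ≤-Reasoning

regionII⇒m<d : ∀ m r d p₁ → d + (p₁ + p₁) ≡ 3 * m + (r + r) → suc p₁ ≤ r + m → m < d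
regionII⇒m<d m r d p₁ d≡ p₁<r+m = ≤-trans (n≤1+n (suc m)) (+-cancelʳ-≤ (r + r + (m + m)) (suc (suc m)) d (begin
  suc (suc m) + (r + r + (m + m))  ≡⟨ solve (m ∷ r ∷ []) ⟩
  3 * m + (r + r) + 2              ≡⟨ cong (_+ 2) d≡ ⟨
  d + (p₁ + p₁) + 2                ≡⟨ solve (d ∷ p₁ ∷ []) ⟩
  d + (suc p₁ + suc p₁)            ≤⟨ +-monoʳ-≤ d (+-mono-≤ p₁<r+m p₁<r+m) ⟩
  d + ((r + m) + (r + m))          ≡⟨ solve (d ∷ r ∷ m ∷ []) ⟩
  d + (r + r + (m + m))            ∎))
  where open ≤-Reasoning

regionIII⇒d≤m : ∀ m r d p₁ → d + p₁ ≡ m + m + r → r + m ≤ p₁ → d ≤ m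
regionIII⇒d≤m m r d p₁ d≡ r+m≤p₁ = +-cancelʳ-≤ (r + m) d m (begin
  d + (r + m)   ≤⟨ +-monoʳ-≤ d r+m≤p₁ ⟩
  d + p₁        ≡⟨ d≡ ⟩
  m + m + r     ≡⟨ solve (m ∷ r ∷ []) ⟩
  m + (r + m)   ∎)
  where open ≤-Reasoning

regionI≢regionII : ∀ m r d p₂ p₁ → d + (p₂ + p₂) ≡ 3 * m + 1 → d + (p₁ + p₁) ≡ 3 * m + (r + r) → ⊥
regionI≢regionII m r d p₂ p₁ I II = even≢odd (p₂ + r) p₁ (+-cancelˡ-≡ d _ _ (begin
  d + 2 * (p₂ + r)         ≡⟨ solve (d ∷ p₂ ∷ r ∷ []) ⟩
  d + (p₂ + p₂) + (r + r)  ≡⟨ cong (_+ (r + r)) I ⟩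
  3 * m + 1 + (r + r)      ≡⟨ solve (m ∷ r ∷ []) ⟩
  suc (3 * m + (r + r))    ≡⟨ cong suc II ⟨
  suc (d + (p₁ + p₁))      ≡⟨ solve (d ∷ p₁ ∷ []) ⟩
  d + suc (2 * p₁)         ∎))
  where open ≡-Reasoning

region-injective : ∀ {m r p₁ p₂ p₁′ p₂′ s d} → p₂ ≤ m → p₂′ ≤ m → p₁ + p₂ ≡ p₁′ + p₂′ →
  Region m r p₁ p₂ s d → Region m r p₁′ p₂′ s d → p₁ ≡ p₁′ × p₂ ≡ p₂′
region-injective {m} {r} {p₁} {p₂} {p₁′} {p₂′} {s} {d} _ _ area≡ (regionI _ _ d≡) (regionI _ _ d≡′) =
  +-cancelʳ-≡ p₂ p₁ p₁′ (trans area≡ (cong (p₁′ +_) (sym p₂≡p₂′))) , p₂≡p₂′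
  where
  p₂≡p₂′ : p₂ ≡ p₂′
  p₂≡p₂′ = double-injective p₂ p₂′ (+-cancelˡ-≡ d _ _ (trans d≡ (sym d≡′)))
region-injective {m} {r} {p₁} {p₂} {p₁′} {p₂′} {s} {d} _ _ area≡ (regionII _ _ _ d≡) (regionII _ _ _ d≡′) =
  p₁≡p₁′ , +-cancelˡ-≡ p₁ p₂ p₂′ (trans area≡ (cong (_+ p₂′) (sym p₁≡p₁′)))
  where
  p₁≡p₁′ : p₁ ≡ p₁′
  p₁≡p₁′ = double-injective p₁ p₁′ (+-cancelˡ-≡ d _ _ (trans d≡ (sym d≡′)))
region-injective {m} {r} {p₁} {p₂} {p₁′} {p₂′} {s} {d} _ _ _ (regionIII _ s≡ d≡) (regionIII _ s≡′ d≡′) =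
  +-cancelˡ-≡ _ _ _ (trans d≡ (sym d≡′)) , +-cancelˡ-≡ _ _ _ (trans s≡ (sym s≡′))
region-injective {m} {r} {p₁} {p₂} {p₁′} {p₂′} {s} {d} _ _ _ (regionI _ _ d≡) (regionII _ _ _ d≡′) = ⊥-elim (regionI≢regionII m r d p₂ p₁′ d≡ d≡′)
region-injective {m} {r} {p₁} {p₂} {p₁′} {p₂′} {s} {d} _ _ _ (regionII _ _ _ d≡) (regionI _ _ d≡′) = ⊥-elim (regionI≢regionII m r d p₂′ p₁ d≡′ d≡)
region-injective {m} {r} {p₁} {p₂} {p₁′} {p₂′} {s} {d} p₂≤m _ _ (regionI _ _ d≡) (regionIII III _ d≡′) =
  ⊥-elim (<-irrefl refl (≤-trans (regionI⇒m<d m d p₂ d≡ p₂≤m) (regionIII⇒d≤m m r d p₁′ d≡′ III)))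
region-injective {m} {r} {p₁} {p₂} {p₁′} {p₂′} {s} {d} _ p₂′≤m _ (regionIII III _ d≡) (regionI _ _ d≡′) =
  ⊥-elim (<-irrefl refl (≤-trans (regionI⇒m<d m d p₂′ d≡′ p₂′≤m) (regionIII⇒d≤m m r d p₁ d≡ III)))
region-injective {m} {r} {p₁} {p₂} {p₁′} {p₂′} {s} {d} _ _ _ (regionII _ II _ d≡) (regionIII III _ d≡′) =
  ⊥-elim (<-irrefl refl (≤-trans (regionII⇒m<d m r d p₁ d≡ II) (regionIII⇒d≤m m r d p₁′ d≡′ III)))
region-injective {m} {r} {p₁} {p₂} {p₁′} {p₂′} {s} {d} _ _ _ (regionIII III _ d≡) (regionII _ II _ d≡′) =
  ⊥-elim (<-irrefl refl (≤-trans (regionII⇒m<d m r d p₁′ d≡′ II) (regionIII⇒d≤m m r d p₁ d≡ III)))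

halve : ∀ c → Σ ℕ λ q → c ≡ q + q ⊎ c ≡ suc (q + q)
halve zero    = 0 , inj₁ refl
halve (suc c) with halve c
... | q , inj₁ refl = q , inj₂ refl
... | q , inj₂ refl = suc q , inj₁ (cong suc (sym (+-suc q q)))

parity-split : ∀ m r d → r ≤ 1 → d ≤ 3 * m + r →
  (Σ ℕ λ q → d + (q + q) ≡ 3 * m + 1) ⊎ (Σ ℕ λ q → d + (q + q) ≡ 3 * m + (r + r))
parity-split m r d r≤1 d≤ with m≤n⇒∃[o]m+o≡n d≤
... | c , d+c≡ with halve c | r | r≤1
...   | q , inj₁ refl | zero     | _ = inj₂ (q , d+c≡)
...   | q , inj₂ refl | zero     | _ = inj₁ (suc q , (begin
  d + (suc q + suc q)   ≡⟨ solve (d ∷ q ∷ []) ⟩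
  d + suc (q + q) + 1   ≡⟨ cong (_+ 1) d+c≡ ⟩
  3 * m + 0 + 1         ≡⟨ solve (m ∷ []) ⟩
  3 * m + 1             ∎))
  where open ≡-Reasoning
...   | q , inj₁ refl | suc zero | _ = inj₁ (q , d+c≡)
...   | q , inj₂ refl | suc zero | _ = inj₂ (suc q , (begin
  d + (suc q + suc q)   ≡⟨ solve (d ∷ q ∷ []) ⟩
  d + suc (q + q) + 1   ≡⟨ cong (_+ 1) d+c≡ ⟩
  3 * m + 1 + 1         ≡⟨ solve (m ∷ []) ⟩
  3 * m + (1 + 1)       ∎))
  where open ≡-Reasoning
...   | _ | suc (suc _) | s≤s ()

record Preimage (m r a s d : ℕ) : Set where
  field
    p₁ p₂  : ℕ
    p₂≤m   : p₂ ≤ m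
    p₁≤    : p₁ ≤ m + r + p₂
    area≡  : a ≡ p₁ + p₂
    region : Region m r p₁ p₂ s d

module _ {m r a s d : ℕ} (r≤1 : r ≤ 1) (s≤a : s ≤ a) (s≤d : s ≤ d) (total : a + s + d ≡ 3 * m + r) where

  preimage-regionIII : d ≤ m → Preimage m r a s d
  preimage-regionIII d≤m with m≤n⇒∃[o]m+o≡n (≤-trans s≤d d≤m) | m≤n⇒∃[o]m+o≡n (≤-trans d≤m (≤-trans (m≤m+n m m) (m≤m+n (m + m) r)))
  ... | p₂ , s+p₂≡m | p₁ , d+p₁≡2m+r = record
    { p₁ = p₁ ; p₂ = p₂ ; p₂≤m = subst (p₂ ≤_) s+p₂≡m (m≤n+m p₂ s) ; p₁≤ = p₁≤ ; area≡ = area≡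
    ; region = regionIII r+m≤p₁ s+p₂≡m d+p₁≡2m+r }
    where
    open ≤-Reasoning
    area≡ : a ≡ p₁ + p₂
    area≡ = +-cancelʳ-≡ (s + d) a (p₁ + p₂) (begin-equality
      a + (s + d)             ≡⟨ sym (+-assoc a s d) ⟩
      a + s + d               ≡⟨ total ⟩
      3 * m + r               ≡⟨ solve (m ∷ r ∷ []) ⟩
      m + m + r + m           ≡⟨ cong₂ _+_ (sym d+p₁≡2m+r) (sym s+p₂≡m) ⟩
      d + p₁ + (s + p₂)       ≡⟨ solve (d ∷ p₁ ∷ s ∷ p₂ ∷ []) ⟩
      p₁ + p₂ + (s + d)       ∎)
    r+m≤p₁ : r + m ≤ p₁
    r+m≤p₁ = +-cancelˡ-≤ d (r + m) p₁ (begin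
      d + (r + m)   ≤⟨ +-monoˡ-≤ (r + m) d≤m ⟩
      m + (r + m)   ≡⟨ solve (m ∷ r ∷ []) ⟩
      m + m + r     ≡⟨ d+p₁≡2m+r ⟨
      d + p₁        ∎)
    p₁≤ : p₁ ≤ m + r + p₂
    p₁≤ = +-cancelʳ-≤ s p₁ (m + r + p₂) (begin
      p₁ + s        ≤⟨ +-monoʳ-≤ p₁ s≤d ⟩
      p₁ + d        ≡⟨ +-comm p₁ d ⟩
      d + p₁        ≡⟨ d+p₁≡2m+r ⟩
      m + m + r     ≡⟨ cong (λ x → x + m + r) (sym s+p₂≡m) ⟩
      s + p₂ + m + r ≡⟨ solve (s ∷ p₂ ∷ m ∷ r ∷ []) ⟩
      m + r + p₂ + s ∎)

  private
    regionI-balance : ∀ q → d + (q + q) ≡ 3 * m + 1 → a + s + 1 ≡ r + (q + q)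
    regionI-balance q d≡ = +-cancelʳ-≡ d _ _ (begin
      a + s + 1 + d        ≡⟨ solve (a ∷ s ∷ d ∷ []) ⟩
      a + s + d + 1        ≡⟨ cong (_+ 1) total ⟩
      3 * m + r + 1        ≡⟨ solve (m ∷ r ∷ []) ⟩
      r + (3 * m + 1)      ≡⟨ cong (r +_) d≡ ⟨
      r + (d + (q + q))    ≡⟨ solve (r ∷ d ∷ q ∷ []) ⟩
      r + (q + q) + d      ∎)
      where open ≡-Reasoning

    regionI-s<r+q : ∀ q → a + s + 1 ≡ r + (q + q) → s < r + q
    regionI-s<r+q q balance = ≰⇒> λ r+q≤s → <-irrefl refl (begin-strict
      r + (q + q)          ≤⟨ ≤-witness r (solve (r ∷ q ∷ [])) ⟩
      (r + q) + (r + q)    ≤⟨ +-mono-≤ r+q≤s r+q≤s ⟩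
      s + s                <⟨ n<1+n (s + s) ⟩
      suc (s + s)          ≤⟨ s≤s (+-monoˡ-≤ s s≤a) ⟩
      suc (a + s)          ≡⟨ +-comm 1 (a + s) ⟩
      a + s + 1            ≡⟨ balance ⟩
      r + (q + q)          ∎)
      where open ≤-Reasoning

  preimage-regionI : m < d → ∀ q → d + (q + q) ≡ 3 * m + 1 → Preimage m r a s d
  preimage-regionI m<d q d≡ with m≤n⇒∃[o]m+o≡n (regionI-s<r+q q (regionI-balance q d≡))
  ... | p₁ , 1+s+p₁≡r+q = record
    { p₁ = p₁ ; p₂ = q ; p₂≤m = q≤m ; p₁≤ = p₁≤ ; area≡ = area≡
    ; region = regionI (subst (suc p₁ ≤_) 1+s+p₁≡r+q (s≤s (m≤n+m p₁ s))) 1+s+p₁≡r+q d≡ }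
    where
    open ≤-Reasoning
    q≤m : q ≤ m
    q≤m = ≮⇒≥ λ m<q → <-irrefl refl (begin-strict
      3 * m + 1                     <⟨ ≤-witness 1 (solve (m ∷ [])) ⟩
      suc m + (suc m + suc m)       ≤⟨ +-mono-≤ m<d (+-mono-≤ m<q m<q) ⟩
      d + (q + q)                   ≡⟨ d≡ ⟩
      3 * m + 1                     ∎)
    area≡ : a ≡ p₁ + q
    area≡ = +-cancelʳ-≡ (suc s) a (p₁ + q) (begin-equality
      a + suc s            ≡⟨ solve (a ∷ s ∷ []) ⟩
      a + s + 1            ≡⟨ regionI-balance q d≡ ⟩
      r + (q + q)          ≡⟨ +-assoc r q q ⟨
      r + q + q            ≡⟨ cong (_+ q) 1+s+p₁≡r+q ⟨
      suc s + p₁ + q       ≡⟨ solve (s ∷ p₁ ∷ q ∷ []) ⟩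
      p₁ + q + suc s       ∎)
    p₁≤ : p₁ ≤ m + r + q
    p₁≤ = begin
      p₁                   ≤⟨ m≤n+m p₁ (suc s) ⟩
      suc s + p₁           ≡⟨ 1+s+p₁≡r+q ⟩
      r + q                ≤⟨ +-monoˡ-≤ q (m≤n+m r m) ⟩
      m + r + q            ∎

  private
    regionII-balance : ∀ q → d + (q + q) ≡ 3 * m + (r + r) → a + s + r ≡ q + q
    regionII-balance q d≡ = +-cancelʳ-≡ d _ _ (begin
      a + s + r + d        ≡⟨ solve (a ∷ s ∷ r ∷ d ∷ []) ⟩
      a + s + d + r        ≡⟨ cong (_+ r) total ⟩
      3 * m + r + r        ≡⟨ solve (m ∷ r ∷ []) ⟩
      3 * m + (r + r)      ≡⟨ d≡ ⟨
      d + (q + q)          ≡⟨ +-comm d (q + q) ⟩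
      q + q + d            ∎)
      where open ≡-Reasoning

    regionII-s+r≤q : ∀ q → a + s + r ≡ q + q → s + r ≤ q
    regionII-s+r≤q q balance = ≮⇒≥ λ q<s+r → <-irrefl refl (begin-strict
      q + q + r            ≤⟨ +-monoʳ-≤ (q + q) r≤1 ⟩
      q + q + 1            <⟨ ≤-witness 0 (solve (q ∷ [])) ⟩
      suc q + suc q        ≤⟨ +-mono-≤ q<s+r q<s+r ⟩
      (s + r) + (s + r)    ≡⟨ solve (s ∷ r ∷ []) ⟩
      s + s + r + r        ≤⟨ +-monoˡ-≤ r (+-monoˡ-≤ r (+-monoˡ-≤ s s≤a)) ⟩
      a + s + r + r        ≡⟨ cong (_+ r) balance ⟩
      q + q + r            ∎)
      where open ≤-Reasoning

  preimage-regionII : m < d → ∀ q → d + (q + q) ≡ 3 * m + (r + r) → Preimage m r a s d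
  preimage-regionII m<d q d≡ with m≤n⇒∃[o]m+o≡n (regionII-s+r≤q q (regionII-balance q d≡))
  ... | p₂ , s+r+p₂≡q = record
    { p₁ = q ; p₂ = p₂ ; p₂≤m = p₂≤m ; p₁≤ = q≤ ; area≡ = area≡
    ; region = regionII r+p₂≤q q<r+m (trans (sym (+-assoc s r p₂)) s+r+p₂≡q) d≡ }
    where
    open ≤-Reasoning
    q<r+m : q < r + m
    q<r+m = ≰⇒> λ r+m≤q → <-irrefl refl (begin-strict
      3 * m + (r + r)                  <⟨ ≤-witness 0 (solve (m ∷ r ∷ [])) ⟩
      suc m + ((r + m) + (r + m))      ≤⟨ +-mono-≤ m<d (+-mono-≤ r+m≤q r+m≤q) ⟩
      d + (q + q)                      ≡⟨ d≡ ⟩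
      3 * m + (r + r)                  ∎)
    r+p₂≤q : r + p₂ ≤ q
    r+p₂≤q = begin
      r + p₂        ≤⟨ m≤n+m (r + p₂) s ⟩
      s + (r + p₂)  ≡⟨ sym (+-assoc s r p₂) ⟩
      s + r + p₂    ≡⟨ s+r+p₂≡q ⟩
      q             ∎
    p₂≤m : p₂ ≤ m
    p₂≤m = <⇒≤ (+-cancelˡ-< r p₂ m (≤-<-trans r+p₂≤q q<r+m))
    q≤ : q ≤ m + r + p₂
    q≤ = begin
      q             ≤⟨ <⇒≤ q<r+m ⟩
      r + m         ≤⟨ ≤-witness p₂ (solve (r ∷ m ∷ p₂ ∷ [])) ⟩
      m + r + p₂    ∎
    area≡ : a ≡ q + p₂
    area≡ = +-cancelʳ-≡ (s + r) a (q + p₂) (begin-equality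
      a + (s + r)          ≡⟨ sym (+-assoc a s r) ⟩
      a + s + r            ≡⟨ regionII-balance q d≡ ⟩
      q + q                ≡⟨ cong (q +_) s+r+p₂≡q ⟨
      q + (s + r + p₂)     ≡⟨ solve (q ∷ s ∷ r ∷ p₂ ∷ []) ⟩
      q + p₂ + (s + r)     ∎)

  preimage : Preimage m r a s d
  preimage with d ≤? m
  ... | yes d≤m = preimage-regionIII d≤m
  ... | no  d≰m with parity-split m r d r≤1 (subst (d ≤_) total (m≤n+m d (a + s)))
  ...   | inj₁ (q , d≡) = preimage-regionI (≰⇒> d≰m) q d≡
  ...   | inj₂ (q , d≡) = preimage-regionII (≰⇒> d≰m) q d≡

module _ {m : ℕ} where
  open Coordinates

  private
    module Skip₀ (c : Coordinates m 0) = SkipOf3m+1 m (toPath c) (p₁ c) (p₂ c) (height-toPath₁ c) (height-toPath₂ c)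
    module Skip₁ (c : Coordinates m 1) = SkipOf3m+2 m (toPath c) (p₁ c) (p₂ c) (height-toPath₁ c) (height-toPath₂ c)

  skip-regionI : ∀ r → r ≤ 1 → (c : Coordinates m r) → suc (p₁ c) ≤ r + p₂ c →
    suc (skip (3 * m + suc r) (toPath c) + p₁ c) ≡ r + p₂ c
  skip-regionI zero _ c p₁<p₂ with m≤n⇒∃[o]m+o≡n p₁<p₂
  ... | w , 1+p₁+w≡p₂ = trans (cong (λ k → suc (k + p₁ c)) skip≡w) (trans (cong suc (+-comm w (p₁ c))) 1+p₁+w≡p₂)
    where
    skip≡w : skip (3 * m + 1) (toPath c) ≡ w
    skip≡w = Skip₀.skip-p₁≤p₂ c (suc w) (y c) (trans (+-suc (p₁ c) w) 1+p₁+w≡p₂) (p₂+y≡m c)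
  skip-regionI (suc zero) _ c p₁≤p₂ with m≤n⇒∃[o]m+o≡n (≤-pred p₁≤p₂)
  ... | w , p₁+w≡p₂ = cong suc (trans (cong (_+ p₁ c) skip≡w) (trans (+-comm w (p₁ c)) p₁+w≡p₂))
    where
    skip≡w : skip (3 * m + 2) (toPath c) ≡ w
    skip≡w = Skip₁.skip-p₁≤p₂ c w (y c) p₁+w≡p₂ (p₂+y≡m c)
  skip-regionI (suc (suc _)) (s≤s ()) c _

  skip-regionII : ∀ r → r ≤ 1 → (c : Coordinates m r) → r + p₂ c ≤ p₁ c → suc (p₁ c) ≤ r + m →
    skip (3 * m + suc r) (toPath c) + (r + p₂ c) ≡ p₁ c
  skip-regionII zero _ c p₂≤p₁ p₁<m with m≤n⇒∃[o]m+o≡n p₂≤p₁ | m≤n⇒∃[o]m+o≡n p₁<m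
  ... | zero , p₂+0≡p₁ | _ =
    trans (cong (_+ p₂ c) (Skip₀.skip-p₁≤p₂ c 0 (y c) (trans (+-identityʳ (p₁ c)) (sym (trans (sym (+-identityʳ (p₂ c))) p₂+0≡p₁))) (p₂+y≡m c)))
          (trans (sym (+-identityʳ (p₂ c))) p₂+0≡p₁)
  ... | suc w , p₂+1+w≡p₁ | v , 1+p₁+v≡m =
    trans (cong (_+ p₂ c) (Skip₀.skip-p₂<p₁≤m c w (suc v) p₂+1+w≡p₁ (trans (+-suc (p₁ c) v) 1+p₁+v≡m)))
          (trans (+-comm (suc w) (p₂ c)) p₂+1+w≡p₁)
  skip-regionII (suc zero) _ c p₂<p₁ p₁≤m with m≤n⇒∃[o]m+o≡n p₂<p₁ | m≤n⇒∃[o]m+o≡n (≤-pred p₁≤m)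
  ... | w , 1+p₂+w≡p₁ | v , p₁+v≡m =
    trans (cong (_+ suc (p₂ c)) (Skip₁.skip-p₂≤p₁≤m c (suc w) v (trans (+-suc (p₂ c) w) 1+p₂+w≡p₁) p₁+v≡m))
          (trans (+-comm w (suc (p₂ c))) 1+p₂+w≡p₁)
  skip-regionII (suc (suc _)) (s≤s ()) c _ _

  private
    gapClosed : ∀ g y → GapClosed y (g + y)
    gapClosed g zero    = inj₁ refl
    gapClosed g (suc y) = inj₂ (≤-trans (s≤s z≤n) (m≤n+m (suc y) g))

  skip-regionIII : ∀ r → r ≤ 1 → (c : Coordinates m r) → r + m ≤ p₁ c →
    skip (3 * m + suc r) (toPath c) + p₂ c ≡ m
  skip-regionIII zero _ c m≤p₁ with m≤n⇒∃[o]m+o≡n m≤p₁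
  ... | zero , m+0≡p₁ with m≤n⇒∃[o]m+o≡n (subst (p₂ c ≤_) (trans (sym (+-identityʳ m)) m+0≡p₁) (p₂≤m c))
  ...   | zero , p₂+0≡p₁ =
    trans (cong (_+ p₂ c) (Skip₀.skip-p₁≤p₂ c 0 0 (trans (+-identityʳ (p₁ c)) (sym p₂≡p₁)) (trans (+-identityʳ (p₂ c)) p₂≡m))) p₂≡m
    where
    p₂≡p₁ : p₂ c ≡ p₁ c
    p₂≡p₁ = trans (sym (+-identityʳ (p₂ c))) p₂+0≡p₁
    p₂≡m : p₂ c ≡ m
    p₂≡m = trans p₂≡p₁ (trans (sym m+0≡p₁) (+-identityʳ m))
  ...   | suc k , p₂+1+k≡p₁ =
    trans (cong (_+ p₂ c) (Skip₀.skip-p₂<p₁≤m c k 0 p₂+1+k≡p₁ p₁+0≡m)) (trans (+-comm (suc k) (p₂ c)) (trans p₂+1+k≡p₁ (trans (sym (+-identityʳ (p₁ c))) p₁+0≡m)))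
    where
    p₁+0≡m : p₁ c + 0 ≡ m
    p₁+0≡m = trans (+-identityʳ (p₁ c)) (trans (sym m+0≡p₁) (+-identityʳ m))
  skip-regionIII zero _ c m≤p₁ | suc f , m+1+f≡p₁ =
    trans (cong (_+ p₂ c) (Skip₀.skip-m<p₁ c (y c) f (g c + y c) (p₂+y≡m c) m+1+f≡p₁
            (trans (p₁+g+y≡m+m+r c) (+-identityʳ (m + m))) (gapClosed (g c) (y c))))
          (trans (+-comm (y c) (p₂ c)) (p₂+y≡m c))
  skip-regionIII (suc zero) _ c m<p₁ with m≤n⇒∃[o]m+o≡n m<p₁
  ... | w , 1+m+w≡p₁ =
    trans (cong (_+ p₂ c) (Skip₁.skip-m<p₁ c (y c) w (g c + y c) (p₂+y≡m c) (trans (+-suc m w) 1+m+w≡p₁)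
            (p₁+g+y≡m+m+r c) (gapClosed (g c) (y c))))
          (trans (+-comm (y c) (p₂ c)) (p₂+y≡m c))
  skip-regionIII (suc (suc _)) (s≤s ()) c _

module _ {m r : ℕ} (r≤1 : r ≤ 1) where

  dinv-regionI : ∀ (c : Coordinates m r) → suc (Coordinates.p₁ c) ≤ r + Coordinates.p₂ c →
    dinv (3 * m + suc r) (Coordinates.toPath c) + (Coordinates.p₂ c + Coordinates.p₂ c) ≡ 3 * m + 1
  dinv-regionI c@(record { p₁ = p₁ ; p₂ = p₂ ; g = g ; y = y ; p₂+y≡m = p₂+y≡m ; p₁+g≡m+r+p₂ = p₁+g≡ }) p₁<r+p₂ = begin
    dinv (3 * m + suc r) (Coordinates.toPath c) + (p₂ + p₂)
      ≡⟨ cong (_+ (p₂ + p₂)) (trans (dinv-toPath r≤1 c) (cong (_+ y) (dinv₁-long r≤1 c (regionI⇒m<g c p₁<r+p₂)))) ⟩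
    suc m + y + y + (p₂ + p₂)
      ≡⟨ solve (m ∷ y ∷ p₂ ∷ []) ⟩
    suc m + ((p₂ + y) + (p₂ + y))
      ≡⟨ cong (λ x → suc m + (x + x)) p₂+y≡m ⟩
    suc m + (m + m)
      ≡⟨ solve (m ∷ []) ⟩
    3 * m + 1 ∎
    where open ≡-Reasoning

  dinv-regionII : ∀ (c : Coordinates m r) → r + Coordinates.p₂ c ≤ Coordinates.p₁ c → suc (Coordinates.p₁ c) ≤ r + m →
    dinv (3 * m + suc r) (Coordinates.toPath c) + (Coordinates.p₁ c + Coordinates.p₁ c) ≡ 3 * m + (r + r)
  dinv-regionII c@(record { p₁ = p₁ ; g = g ; y = y }) r+p₂≤p₁ p₁<r+m
    with m≤n⇒∃[o]m+o≡n (regionII⇒g≤m c r+p₂≤p₁) | m≤n⇒∃[o]m+o≡n (<⇒≤ (regionII⇒m<g+y c p₁<r+m))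
  ... | e , g+e≡m | f , m+f≡g+y = begin
    dinv (3 * m + suc r) (Coordinates.toPath c) + (p₁ + p₁)
      ≡⟨ cong (_+ (p₁ + p₁)) (trans (dinv-toPath r≤1 c) (cong (_+ y) (dinv₁-middle r≤1 c e f g+e≡m (sym m+f≡g+y)))) ⟩
    g + f + y + (p₁ + p₁)
      ≡⟨ solve (g ∷ f ∷ y ∷ p₁ ∷ []) ⟩
    (g + y) + f + (p₁ + p₁)
      ≡⟨ cong (λ x → x + f + (p₁ + p₁)) (sym m+f≡g+y) ⟩
    m + f + f + (p₁ + p₁)
      ≡⟨ solve (m ∷ f ∷ p₁ ∷ []) ⟩
    m + ((p₁ + f) + (p₁ + f))
      ≡⟨ cong (λ x → m + (x + x)) p₁+f≡m+r ⟩
    m + ((m + r) + (m + r))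
      ≡⟨ solve (m ∷ r ∷ []) ⟩
    3 * m + (r + r) ∎
    where
    open ≡-Reasoning
    p₁+f≡m+r : p₁ + f ≡ m + r
    p₁+f≡m+r = +-cancelˡ-≡ m _ _ (begin
      m + (p₁ + f)    ≡⟨ solve (m ∷ p₁ ∷ f ∷ []) ⟩
      p₁ + (m + f)    ≡⟨ cong (p₁ +_) m+f≡g+y ⟩
      p₁ + (g + y)    ≡⟨ Coordinates.p₁+g+y≡m+m+r c ⟩
      m + m + r       ≡⟨ +-assoc m m r ⟩
      m + (m + r)     ∎)

  dinv-regionIII : ∀ (c : Coordinates m r) → r + m ≤ Coordinates.p₁ c →
    dinv (3 * m + suc r) (Coordinates.toPath c) + Coordinates.p₁ c ≡ m + m + r
  dinv-regionIII c r+m≤p₁ = begin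
    dinv (3 * m + suc r) toPath + p₁
      ≡⟨ cong (_+ p₁) (trans (dinv-toPath r≤1 c) (cong (_+ y) (dinv₁-short r≤1 c (regionIII⇒g+y≤m c r+m≤p₁)))) ⟩
    g + y + p₁
      ≡⟨ +-comm (g + y) p₁ ⟩
    p₁ + (g + y)
      ≡⟨ p₁+g+y≡m+m+r ⟩
    m + m + r ∎
    where
    open ≡-Reasoning
    open Coordinates c

  region-toPath : ∀ (c : Coordinates m r) →
    Region m r (Coordinates.p₁ c) (Coordinates.p₂ c) (skip (3 * m + suc r) (Coordinates.toPath c)) (dinv (3 * m + suc r) (Coordinates.toPath c))
  region-toPath c with suc (Coordinates.p₁ c) ≤? r + Coordinates.p₂ c
  ... | yes I = regionI I (skip-regionI r r≤1 c I) (dinv-regionI c I)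
  ... | no ¬I with suc (Coordinates.p₁ c) ≤? r + m
  ...   | yes II = regionII (≤-pred (≰⇒> ¬I)) II (skip-regionII r r≤1 c (≤-pred (≰⇒> ¬I)) II) (dinv-regionII c (≤-pred (≰⇒> ¬I)) II)
  ...   | no ¬II = regionIII (≤-pred (≰⇒> ¬II)) (skip-regionIII r r≤1 c (≤-pred (≰⇒> ¬II))) (dinv-regionIII c (≤-pred (≰⇒> ¬II)))

residue : ∀ x → ¬ (3 ∣ x) → Σ ℕ λ m → Σ ℕ λ r → r ≤ 1 × x ≡ 3 * m + suc r
residue x 3∤x with x % 3 in x%3≡ | m%n<n x 3
... | zero  | _ = ⊥-elim (3∤x (m%n≡0⇒n∣m x 3 x%3≡))
... | suc r | s≤s (s≤s r≤1) = x / 3 , r , r≤1 , trans (m≡m%n+[m/n]*n x 3)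
  (trans (cong (_+ (x / 3) * 3) x%3≡) (trans (+-comm (suc r) _) (cong (_+ suc r) (*-comm (x / 3) 3))))

HasStatistics : ℕ → ℕ → ℕ → ℕ → List Step → Set
HasStatistics n a s d Π = IsDyck n Π × area n Π ≡ a × skip n Π ≡ s × dinv n Π ≡ d

unique-path : ∀ m r a s d → r ≤ 1 → s ≤ a → s ≤ d → a + s + d ≡ 3 * m + r →
  ∃! _≡_ (HasStatistics (3 * m + suc r) a s d)
unique-path m r a s d r≤1 s≤a s≤d total = toPath c , statistics , λ {Π′} → uniqueness Π′
  where
  open Preimage (preimage {m} r≤1 s≤a s≤d total)
  open Coordinates using (toPath)
  n : ℕ
  n = 3 * m + suc r
  c : Coordinates m r
  c = mkCoordinates p₁ p₂ p₂≤m p₁≤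
  statistics : HasStatistics n a s d (toPath c)
  statistics with region-functional p₂≤m (region-toPath r≤1 c) region
  ... | skip≡s , dinv≡d = Coordinates.toPath-isDyck c r≤1 , trans (area-toPath r≤1 c) (sym area≡) , skip≡s , dinv≡d
  uniqueness : ∀ Π′ → HasStatistics n a s d Π′ → toPath c ≡ Π′
  uniqueness Π′ (D , area′ , skip′ , dinv′) with isDyck⇒coordinates m r r≤1 Π′ D
  ... | c′ , refl with region-injective p₂≤m (Coordinates.p₂≤m c′)
                         (trans (sym area≡) (trans (sym area′) (area-toPath r≤1 c′)))
                         region (subst₂ (Region m r _ _) skip′ dinv′ (region-toPath r≤1 c′))
  ... | p₁≡ , p₂≡ = toPath-determined c c′ p₁≡ p₂≡

mainTheorem8 : (a s d : ℕ) → s ≤ a → s ≤ d → ¬ (3 ∣ a + s + d + 1) →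
    ∃! {A = List Step} _≡_ (λ Π → IsDyck (a + s + d + 1) Π × area (a + s + d + 1) Π ≡ a
    × skip (a + s + d + 1) Π ≡ s × dinv (a + s + d + 1) Π ≡ d)
mainTheorem8 a s d s≤a s≤d 3∤n with residue (a + s + d + 1) 3∤n
... | m , r , r≤1 , n≡ = subst (λ n → ∃! _≡_ (HasStatistics n a s d)) (sym n≡)
  (unique-path m r a s d r≤1 s≤a s≤d (suc-injective (trans (+-comm 1 (a + s + d)) (trans n≡ (+-suc (3 * m) r)))))
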